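{- For every positive integer $n$, $\left\langle m_{(1,1)}^n, s_{(2^n)} \right\rangle = R(n)$, the $n$-th Riordan number.
   Context: $m_{(1,1)}$ is the monomial symmetric function indexed by the partition $(1,1)$, $s_{(2^n)}$ is the Schur function indexed by the partition with $n$ parts equal to $2$, and $\langle\cdot,\cdot\rangle$ is the Hall inner product on symmetric functions (for which the Schur functions form an orthonormal basis). A Riordan path of length $n$ is a lattice path from $(0,0)$ to $(n,0)$ with steps $U=(1,1)$, $F=(1,0)$, $D=(1,-1)$, never going below the $x$-axis, and with no $F$ step on the $x$-axis; $R(n)$ is the number of such paths. -}

module Defs where

open import Data.Nat as ℕ using (ℕ; zero; suc; _∸_; _<ᵇ_; _≤ᵇ_; _≡ᵇ_)
open import Data.Integer as ℤ using (ℤ; +_; _-_; _*_; _+_; sign)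
open import Data.Fin using (Fin; toℕ)
open import Data.List using (List; []; _∷_; map; concatMap; upTo; allFin; foldr; filter; length)
open import Data.Vec using (Vec; []; _∷_)
open import Data.Vec.Functional using (head; tail) renaming (_∷_ to _∷ᶠ_)
open import Data.Bool using (Bool; true; false; if_then_else_; _∧_)

sumℤ : List ℤ → ℤ
sumℤ = foldr _+_ (+ 0)

prodℤ : List ℤ → ℤ
prodℤ = foldr _*_ (+ 1)

-- Polynomials in N commuting variables x_0,…,x_{N-1} with integer
-- coefficients, represented by their coefficient function on exponent
-- vectors (monomials x^α, α : Fin N → ℕ).

Mon : ℕ → Set
Mon N = Fin N → ℕ

Poly : ℕ → Set
Poly N = Mon N → ℤ

sumMon : ∀ {N} → Mon N → ℕ
sumMon {zero} α = 0
sumMon {suc N} α = head α ℕ.+ sumMon (tail α)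

below : ∀ {N} → Mon N → List (Mon N)
below {zero} α = (λ ()) ∷ []
below {suc N} α =
  concatMap (λ b → map (b ∷ᶠ_) (below (tail α))) (upTo (suc (head α)))

mulP : ∀ {N} → Poly N → Poly N → Poly N
mulP f g α = sumℤ (map (λ β → f β * g (λ i → α i ∸ β i)) (below α))

oneP : ∀ {N} → Poly N
oneP α = if sumMon α ≡ᵇ 0 then + 1 else + 0

powP : ∀ {N} → Poly N → ℕ → Poly N
powP f zero = oneP
powP f (suc n) = mulP f (powP f n)

-- the monomial symmetric function m_(1,1) in N variables:
-- sum of x_i x_j over i < j, i.e. coefficient 1 exactly on exponent
-- vectors that are rearrangements of (1,1,0,…,0).
allLe1 : ∀ {N} → Mon N → Bool
allLe1 {zero} α = true
allLe1 {suc N} α = (head α ≤ᵇ 1) ∧ allLe1 (tail α)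

m11 : (N : ℕ) → Poly N
m11 N α = if allLe1 α ∧ (sumMon α ≡ᵇ 2) then + 1 else + 0

-- Maps Fin N → Fin N and the Leibniz sign
-- sgn σ = ∏_{i<j} sign(σ j − σ i), which is the sign of σ if σ is a
-- permutation and 0 otherwise.

allMaps : (N k : ℕ) → List (Fin N → Fin k)
allMaps zero k = (λ ()) ∷ []
allMaps (suc N) k =
  concatMap (λ i → map (i ∷ᶠ_) (allMaps N k)) (allFin k)

sgnℤ : ℤ → ℤ
sgnℤ (+ zero) = + 0
sgnℤ (+ suc _) = + 1
sgnℤ ℤ.-[1+ _ ] = ℤ.-[1+ 0 ]

sgn : ∀ {N} → (Fin N → Fin N) → ℤ
sgn {N} σ = prodℤ (concatMap (λ i → map (λ j →
               if toℕ i <ᵇ toℕ j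
               then sgnℤ (+ toℕ (σ j) - + toℕ (σ i))
               else + 1) (allFin N)) (allFin N))

-- Coefficient of x^a for an integer exponent vector a (0 if some
-- entry is negative).

coeffℤ : ∀ {N} → Poly N → (Fin N → ℤ) → ℤ
coeffℤ {N} f a = go (allFin N)
  where
  nonneg : ℤ → Bool
  nonneg (+ _) = true
  nonneg ℤ.-[1+ _ ] = false
  go : List (Fin N) → ℤ
  go [] = f (λ i → ℤ.∣ a i ∣)
  go (i ∷ is) = if nonneg (a i) then go is else + 0

-- The Hall inner product is defined by ⟨m_μ, h_ν⟩ = δ_{μν}, so for a
-- symmetric function f, ⟨f, h_{a_1} ⋯ h_{a_N}⟩ is the coefficient of
-- x^a in f (0 if some a_i < 0).  Using the Jacobi–Trudi definition
--   s_λ = det [ h_{λ_i − i + j} ]_{i,j},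
-- we get ⟨f, s_λ⟩ = Σ_σ sgn σ · [x^{(λ_i − i + σ(i))_i}] f.
-- Here f is given by its expansion in N ≥ ℓ(λ) variables, which
-- determines all these coefficients.

hallSchur : (N : ℕ) → Poly N → (λ' : Fin N → ℕ) → ℤ
hallSchur N f λ' = sumℤ (map (λ σ → sgn σ *
   coeffℤ f (λ i → + λ' i - + toℕ i + + toℕ (σ i))) (allMaps N N))

data Step : Set where
  U F D : Step

allPaths : (n : ℕ) → List (Vec Step n)
allPaths zero = [] ∷ []
allPaths (suc n) =
  concatMap (λ s → map (s ∷_) (allPaths n)) (U ∷ F ∷ D ∷ [])

validFrom : ∀ {n} → ℕ → Vec Step n → Bool
validFrom zero [] = true
validFrom (suc _) [] = false
validFrom h (U ∷ p) = validFrom (suc h) p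
validFrom zero (F ∷ p) = false
validFrom (suc h) (F ∷ p) = validFrom (suc h) p
validFrom zero (D ∷ p) = false
validFrom (suc h) (D ∷ p) = validFrom h p

isRiordan : ∀ {n} → Vec Step n → Bool
isRiordan = validFrom 0

R : ℕ → ℕ
R n = sumℕ (map (λ p → if isRiordan p then 1 else 0) (allPaths n))
  where
  sumℕ : List ℕ → ℕ
  sumℕ = foldr ℕ._+_ 0

-- By Jacobi–Trudi, ⟨f, s_λ⟩ = Σ_σ sgn σ · [x^(λ_i − i + σ i)] f. This makes sense for every integer
-- sequence λ; it vanishes when the last entry is −1 and, for symmetric f, when λ_(p+1) = λ_p + 1.
-- Multiplying by m_(1,1) lowers two distinct rows by one, so
-- ⟨m_(1,1)^(k+1), s_λ⟩ = Σ_(x<y) ⟨m_(1,1)^k, s_(λ − e_x − e_y)⟩. For λ = (2^a, 1^b) all terms but three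
-- vanish, leaving the shapes (2^(a−1), 1^b), (2^(a−2), 1^(b+2)) and (2^a, 1^(b−2)). For b = 2h these
-- are the F, U and D steps of a path at height h (and b = 0 forbids F on the axis), so when
-- a + h = k the pairing ⟨m_(1,1)^k, s_(2^a, 1^(2h))⟩ counts the Riordan-valid paths of length k
-- starting at height h. The theorem is the case a = n, h = 0.

module Submission where

open import Defs
open import Data.Bool using (Bool; true; false; if_then_else_; _∧_; not; T)
import Data.Bool.Properties as Bool
open import Data.Empty using (⊥-elim)
open import Data.Fin as Fin using (Fin; toℕ)
open import Data.Fin.Properties using (toℕ<n; toℕ-fromℕ<; toℕ-fromℕ)
open import Data.Integer as ℤ using (ℤ; +_; -[1+_]; _+_; _*_; -_; _-_; ∣_∣; _⊖_)
import Data.Integer.Properties as ℤ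
open import Data.Integer.Tactic.RingSolver using (solve-∀)
open import Data.List using (List; []; _∷_; map; tabulate; allFin; applyUpTo; upTo; concatMap; _++_; foldr)
import Data.List.Properties as List
open import Data.Nat as ℕ using (ℕ; zero; suc; _<_; _≤_; _≥_; z≤n; s≤s; _<ᵇ_; _≤ᵇ_; _≡ᵇ_; _∸_)
import Data.Nat.Properties as ℕ
open import Data.Sum using (inj₁; inj₂)
import Data.Vec as Vec
open import Data.Vec.Functional using () renaming (_∷_ to _∷ᶠ_)
open import Data.Vec.Functional.Properties using (∷-cong)
open import Function using (_∘_)
open import Function.Definitions using (Congruent)
open import Relation.Binary.PropositionalEquality

when : Bool → ℤ → ℤ
when b x = if b then x else + 0

ι : Bool → ℤ
ι b = if b then + 1 else + 0

ι-pos : ∀ b → + (if b then 1 else 0) ≡ ι b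
ι-pos true = refl
ι-pos false = refl

*-ι : ∀ b x → x * ι b ≡ when b x
*-ι true x = ℤ.*-identityʳ x
*-ι false x = ℤ.*-zeroʳ x

when-zero : ∀ b → when b (+ 0) ≡ + 0
when-zero true = refl
when-zero false = refl

when-≡ : ∀ b {x y} → (b ≡ true → x ≡ y) → when b x ≡ when b y
when-≡ true x≡y = x≡y refl
when-≡ false _ = refl

when-∧ : ∀ b c x → when b (when c x) ≡ when (b ∧ c) x
when-∧ true c x = refl
when-∧ false c x = refl

when-*ˡ : ∀ b c x → c * when b x ≡ when b (c * x)
when-*ˡ true c x = refl
when-*ˡ false c x = ℤ.*-zeroʳ c

+-vanishˡ : ∀ {x y} → x ≡ + 0 → x + y ≡ y
+-vanishˡ {y = y} refl = ℤ.+-identityˡ y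

+-vanishʳ : ∀ {x y} → y ≡ + 0 → x + y ≡ x
+-vanishʳ {x} refl = ℤ.+-identityʳ x

∑ : ∀ {A : Set} → (A → ℤ) → List A → ℤ
∑ f xs = sumℤ (map f xs)

infix 5 ∑
syntax ∑ (λ x → e) xs = ∑[ x ∈ xs ] e

private variable
  A B : Set

∑-cong : ∀ {f g : A → ℤ} → f ≗ g → ∀ xs → ∑ f xs ≡ ∑ g xs
∑-cong f≗g xs = cong sumℤ (List.map-cong f≗g xs)

∑-++ : ∀ (f : A → ℤ) xs ys → ∑ f (xs ++ ys) ≡ ∑ f xs + ∑ f ys
∑-++ f [] ys = sym (ℤ.+-identityˡ _)
∑-++ f (x ∷ xs) ys = trans (cong (_+_ (f x)) (∑-++ f xs ys)) (sym (ℤ.+-assoc (f x) _ _))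

∑-zero : ∀ {f : A → ℤ} → (∀ x → f x ≡ + 0) → ∀ xs → ∑ f xs ≡ + 0
∑-zero f≡0 [] = refl
∑-zero f≡0 (x ∷ xs) = cong₂ _+_ (f≡0 x) (∑-zero f≡0 xs)

∑-+ : ∀ (f g : A → ℤ) xs → ∑[ x ∈ xs ] (f x + g x) ≡ ∑ f xs + ∑ g xs
∑-+ f g [] = refl
∑-+ f g (x ∷ xs) = trans (cong (_+_ (f x + g x)) (∑-+ f g xs)) (interchange (f x) (g x) _ _)
  where
  interchange : ∀ a b c d → a + b + (c + d) ≡ a + c + (b + d)
  interchange = solve-∀

∑-neg : ∀ (f : A → ℤ) xs → ∑[ x ∈ xs ] (- f x) ≡ - ∑ f xs
∑-neg f [] = refl
∑-neg f (x ∷ xs) = trans (cong (_+_ (- f x)) (∑-neg f xs)) (sym (ℤ.neg-distrib-+ (f x) _))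

∑-when : ∀ b (f : A → ℤ) xs → ∑[ x ∈ xs ] when b (f x) ≡ when b (∑ f xs)
∑-when true f xs = refl
∑-when false f xs = ∑-zero (λ _ → refl) xs

∑-map : ∀ (f : B → ℤ) (g : A → B) xs → ∑ f (map g xs) ≡ ∑ (f ∘ g) xs
∑-map f g xs = cong sumℤ (sym (List.map-∘ xs))

∑-concatMap : ∀ (f : B → ℤ) (g : A → List B) xs →
              ∑ f (concatMap g xs) ≡ ∑[ x ∈ xs ] ∑ f (g x)
∑-concatMap f g [] = refl
∑-concatMap f g (x ∷ xs) =
  trans (∑-++ f (g x) (concatMap g xs)) (cong (_+_ (∑ f (g x))) (∑-concatMap f g xs))

∑-comm : ∀ (f : A → B → ℤ) xs ys →
         ∑[ x ∈ xs ] ∑[ y ∈ ys ] f x y ≡ ∑[ y ∈ ys ] ∑[ x ∈ xs ] f x y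
∑-comm f [] ys = sym (∑-zero (λ _ → refl) ys)
∑-comm f (x ∷ xs) ys =
  trans (cong (_+_ (∑ (f x) ys)) (∑-comm f xs ys)) (sym (∑-+ (f x) (λ y → ∑[ x ∈ xs ] f x y) ys))

∑ᶠ : ∀ {n} → (Fin n → ℤ) → ℤ
∑ᶠ {zero} f = + 0
∑ᶠ {suc n} f = f Fin.zero + ∑ᶠ (f ∘ Fin.suc)

infix 5 ∑ᶠ
syntax ∑ᶠ (λ i → e) = ∑ᶠ[ i ] e

∑-allFin : ∀ {n} (f : Fin n → ℤ) → ∑ f (allFin n) ≡ ∑ᶠ f
∑-allFin f = trans (cong sumℤ (List.map-tabulate (λ i → i) f)) (sum-tabulate f)
  where
  sum-tabulate : ∀ {n} (f : Fin n → ℤ) → sumℤ (tabulate f) ≡ ∑ᶠ f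
  sum-tabulate {zero} f = refl
  sum-tabulate {suc n} f = cong (_+_ (f Fin.zero)) (sum-tabulate (f ∘ Fin.suc))

∑ᶠ-cong : ∀ {n} {f g : Fin n → ℤ} → f ≗ g → ∑ᶠ f ≡ ∑ᶠ g
∑ᶠ-cong {zero} f≗g = refl
∑ᶠ-cong {suc n} f≗g = cong₂ _+_ (f≗g Fin.zero) (∑ᶠ-cong (f≗g ∘ Fin.suc))

∑ᶠ-*ˡ : ∀ {n} c (f : Fin n → ℤ) → c * ∑ᶠ f ≡ ∑ᶠ[ i ] c * f i
∑ᶠ-*ˡ {zero} c f = ℤ.*-zeroʳ c
∑ᶠ-*ˡ {suc n} c f = trans (ℤ.*-distribˡ-+ c _ _) (cong (_+_ (c * f Fin.zero)) (∑ᶠ-*ˡ c (f ∘ Fin.suc)))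

∑ᶠ-zero : ∀ {n} {f : Fin n → ℤ} → (∀ i → f i ≡ + 0) → ∑ᶠ f ≡ + 0
∑ᶠ-zero {n} {f} f≡0 = trans (sym (∑-allFin f)) (∑-zero f≡0 (allFin n))

∑ᶠ-+ : ∀ {n} (f g : Fin n → ℤ) → ∑ᶠ[ i ] (f i + g i) ≡ ∑ᶠ f + ∑ᶠ g
∑ᶠ-+ {n} f g = trans (sym (∑-allFin (λ i → f i + g i)))
  (trans (∑-+ f g (allFin n)) (cong₂ _+_ (∑-allFin f) (∑-allFin g)))

∑ᶠ-comm : ∀ {m n} (f : Fin m → Fin n → ℤ) → ∑ᶠ[ i ] ∑ᶠ[ j ] f i j ≡ ∑ᶠ[ j ] ∑ᶠ[ i ] f i j
∑ᶠ-comm {m} {n} f = begin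
  ∑ᶠ[ i ] ∑ᶠ[ j ] f i j                    ≡⟨ ∑-allFin (λ i → ∑ᶠ (f i)) ⟨
  ∑[ i ∈ allFin m ] ∑ᶠ (f i)               ≡⟨ ∑-cong (λ i → ∑-allFin (f i)) (allFin m) ⟨
  ∑[ i ∈ allFin m ] ∑[ j ∈ allFin n ] f i j ≡⟨ ∑-comm f (allFin m) (allFin n) ⟩
  ∑[ j ∈ allFin n ] ∑[ i ∈ allFin m ] f i j ≡⟨ ∑-cong (λ j → ∑-allFin (λ i → f i j)) (allFin n) ⟩
  ∑[ j ∈ allFin n ] ∑ᶠ[ i ] f i j           ≡⟨ ∑-allFin (λ j → ∑ᶠ[ i ] f i j) ⟩
  ∑ᶠ[ j ] ∑ᶠ[ i ] f i j                    ∎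
  where open ≡-Reasoning

∑-∑ᶠ-comm : ∀ {n} (f : A → Fin n → ℤ) xs → ∑[ x ∈ xs ] ∑ᶠ (f x) ≡ ∑ᶠ[ j ] ∑[ x ∈ xs ] f x j
∑-∑ᶠ-comm {n = n} f xs =
  trans (∑-cong (λ x → sym (∑-allFin (f x))) xs)
        (trans (∑-comm f xs (allFin n)) (∑-allFin (λ j → ∑[ x ∈ xs ] f x j)))

<ᵇ-true : ∀ {m n} → m < n → (m <ᵇ n) ≡ true
<ᵇ-true {zero} {suc n} _ = refl
<ᵇ-true {suc m} {suc n} (s≤s m<n) = <ᵇ-true m<n

<ᵇ-false : ∀ {m n} → n ≤ m → (m <ᵇ n) ≡ false
<ᵇ-false {m} {zero} _ = refl
<ᵇ-false {suc m} {suc n} (s≤s n≤m) = <ᵇ-false n≤m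

∑< : ℕ → (ℕ → ℤ) → ℤ
∑< zero f = + 0
∑< (suc n) f = f 0 + ∑< n (f ∘ suc)

infix 5 ∑<
syntax ∑< n (λ t → e) = ∑[ t < n ] e

∑<-cong : ∀ n {f g : ℕ → ℤ} → (∀ t → t < n → f t ≡ g t) → ∑< n f ≡ ∑< n g
∑<-cong zero f≡g = refl
∑<-cong (suc n) f≡g = cong₂ _+_ (f≡g 0 (s≤s z≤n)) (∑<-cong n (λ t t<n → f≡g (suc t) (s≤s t<n)))

∑<-zero : ∀ n {f : ℕ → ℤ} → (∀ t → t < n → f t ≡ + 0) → ∑< n f ≡ + 0
∑<-zero zero f≡0 = refl
∑<-zero (suc n) f≡0 = cong₂ _+_ (f≡0 0 (s≤s z≤n)) (∑<-zero n (λ t t<n → f≡0 (suc t) (s≤s t<n)))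

∑<-+ : ∀ m n (f : ℕ → ℤ) → ∑< (m ℕ.+ n) f ≡ ∑< m f + (∑[ t < n ] f (m ℕ.+ t))
∑<-+ zero n f = sym (ℤ.+-identityˡ _)
∑<-+ (suc m) n f = trans (cong (_+_ (f 0)) (∑<-+ m n (f ∘ suc))) (sym (ℤ.+-assoc (f 0) _ _))

∑<-last : ∀ n (f : ℕ → ℤ) → (∀ t → t < n → f t ≡ + 0) → ∑< (suc n) f ≡ f n
∑<-last zero f _ = ℤ.+-identityʳ (f 0)
∑<-last (suc n) f f≡0 =
  trans (cong₂ _+_ (f≡0 0 (s≤s z≤n)) (∑<-last n (f ∘ suc) (λ t t<n → f≡0 (suc t) (s≤s t<n))))
        (ℤ.+-identityˡ _)

∑<-when-< : ∀ n y (f : ℕ → ℤ) → y ≤ n → ∑[ x < n ] when (x <ᵇ y) (f x) ≡ ∑< y f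
∑<-when-< n y f y≤n = begin
  ∑[ x < n ] when (x <ᵇ y) (f x)
    ≡⟨ cong (λ m → ∑[ x < m ] when (x <ᵇ y) (f x)) (ℕ.m+[n∸m]≡n y≤n) ⟨
  ∑[ x < y ℕ.+ (n ∸ y) ] when (x <ᵇ y) (f x)
    ≡⟨ ∑<-+ y (n ∸ y) _ ⟩
  (∑[ x < y ] when (x <ᵇ y) (f x)) + (∑[ t < n ∸ y ] when (y ℕ.+ t <ᵇ y) (f (y ℕ.+ t)))
    ≡⟨ cong₂ _+_ (∑<-cong y (λ x x<y → cong (λ b → when b (f x)) (<ᵇ-true x<y)))
                 (∑<-zero (n ∸ y) (λ t _ → cong (λ b → when b (f (y ℕ.+ t))) (<ᵇ-false (ℕ.m≤m+n y t)))) ⟩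
  ∑< y f + + 0
    ≡⟨ ℤ.+-identityʳ _ ⟩
  ∑< y f ∎
  where open ≡-Reasoning

∑<-indicator : ∀ m c (f : ℕ → ℤ) → ∑[ t < m ] when (t ≡ᵇ c) (f t) ≡ when (c <ᵇ m) (f c)
∑<-indicator zero c f = refl
∑<-indicator (suc m) zero f = trans (cong (_+_ (f 0)) (∑<-zero m (λ _ _ → refl))) (ℤ.+-identityʳ _)
∑<-indicator (suc m) (suc c) f = trans (ℤ.+-identityˡ _) (∑<-indicator m c (f ∘ suc))

∑-applyUpTo : ∀ (h : ℕ → ℤ) (f : ℕ → ℕ) m → ∑ h (applyUpTo f m) ≡ ∑[ t < m ] h (f t)
∑-applyUpTo h f zero = refl
∑-applyUpTo h f (suc m) = cong (_+_ (h (f 0))) (∑-applyUpTo h (f ∘ suc) m)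

∑ᶠ-toℕ : ∀ {n} (f : ℕ → ℤ) → ∑ᶠ[ i ] f (toℕ {n} i) ≡ ∑< n f
∑ᶠ-toℕ {zero} f = refl
∑ᶠ-toℕ {suc n} f = cong (_+_ (f 0)) (∑ᶠ-toℕ {n} (f ∘ suc))

_≡ᶠ_ : ∀ {n} → Fin n → Fin n → Bool
i ≡ᶠ j = toℕ i ≡ᵇ toℕ j

∑ᶠ-indicator : ∀ {n} (p : Fin n) (f : Fin n → ℤ) → ∑ᶠ[ i ] when (i ≡ᶠ p) (f i) ≡ f p
∑ᶠ-indicator {suc n} Fin.zero f = trans (cong (_+_ (f Fin.zero)) (∑ᶠ-zero {n} (λ _ → refl))) (ℤ.+-identityʳ _)
∑ᶠ-indicator (Fin.suc p) f = trans (ℤ.+-identityˡ _) (∑ᶠ-indicator p (f ∘ Fin.suc))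

_<ᶠ_ : ∀ {n} → Fin n → Fin n → Bool
i <ᶠ j = toℕ i <ᵇ toℕ j

∑pairs : ∀ {n} → (Fin n → Fin n → ℤ) → ℤ
∑pairs T = ∑ᶠ[ i ] ∑ᶠ[ j ] when (i <ᶠ j) (T i j)

infix 5 ∑pairs
syntax ∑pairs (λ i j → e) = ∑⟨ i < j ⟩ e

∑pairs-cong : ∀ {n} {S T : Fin n → Fin n → ℤ} → (∀ i j → S i j ≡ T i j) → ∑pairs S ≡ ∑pairs T
∑pairs-cong S≡T = ∑ᶠ-cong (λ i → ∑ᶠ-cong (λ j → cong (when _) (S≡T i j)))

∑pairs-zero : ∀ {n} {T : Fin n → Fin n → ℤ} → (∀ i j → T i j ≡ + 0) → ∑pairs T ≡ + 0
∑pairs-zero T≡0 = ∑ᶠ-zero (λ i → ∑ᶠ-zero (λ j → trans (cong (when _) (T≡0 i j)) (when-zero _)))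

∑pairs-*ˡ : ∀ {n} c (T : Fin n → Fin n → ℤ) → c * ∑pairs T ≡ ∑⟨ i < j ⟩ c * T i j
∑pairs-*ˡ c T =
  trans (∑ᶠ-*ˡ c (λ i → ∑ᶠ[ j ] when (i <ᶠ j) (T i j)))
        (∑ᶠ-cong (λ i → trans (∑ᶠ-*ˡ c (λ j → when (i <ᶠ j) (T i j)))
                             (∑ᶠ-cong (λ j → when-*ˡ (i <ᶠ j) c (T i j)))))

∑pairs-suc : ∀ {n} (T : Fin (suc n) → Fin (suc n) → ℤ) →
             ∑pairs T ≡ (∑ᶠ[ j ] T Fin.zero (Fin.suc j)) + (∑⟨ i < j ⟩ T (Fin.suc i) (Fin.suc j))
∑pairs-suc T =
  cong₂ _+_ (ℤ.+-identityˡ (∑ᶠ[ j ] T Fin.zero (Fin.suc j)))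
            (∑ᶠ-cong (λ i → ℤ.+-identityˡ (∑ᶠ[ j ] when (i <ᶠ j) (T (Fin.suc i) (Fin.suc j)))))

∑-∑pairs-comm : ∀ {A : Set} {n} (T : A → Fin n → Fin n → ℤ) xs →
                ∑[ x ∈ xs ] ∑pairs (T x) ≡ ∑⟨ i < j ⟩ ∑[ x ∈ xs ] T x i j
∑-∑pairs-comm T xs =
  trans (∑-∑ᶠ-comm (λ x i → ∑ᶠ[ j ] when (i <ᶠ j) (T x i j)) xs)
        (∑ᶠ-cong (λ i → trans (∑-∑ᶠ-comm (λ x j → when (i <ᶠ j) (T x i j)) xs)
                             (∑ᶠ-cong (λ j → ∑-when (i <ᶠ j) (λ x → T x i j) xs))))

∑pairs-toℕ : ∀ {n} (T : ℕ → ℕ → ℤ) →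
             ∑⟨ i < j ⟩ T (toℕ {n} i) (toℕ j) ≡ ∑[ y < n ] ∑[ x < y ] T x y
∑pairs-toℕ {n} T = begin
  ∑pairs {n} (λ i j → T (toℕ i) (toℕ j))
    ≡⟨ ∑ᶠ-comm {n} {n} (λ i j → when (i <ᶠ j) (T (toℕ i) (toℕ j))) ⟩
  ∑ᶠ {n} (λ j → ∑ᶠ[ i ] when (i <ᶠ j) (T (toℕ i) (toℕ j)))
    ≡⟨ ∑ᶠ-cong (λ j → trans (∑ᶠ-toℕ {n} (λ x → when (x <ᵇ toℕ j) (T x (toℕ j))))
                            (∑<-when-< n (toℕ j) (λ x → T x (toℕ j)) (ℕ.<⇒≤ (toℕ<n j)))) ⟩
  ∑ᶠ {n} (λ j → ∑[ x < toℕ j ] T x (toℕ j))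
    ≡⟨ ∑ᶠ-toℕ {n} (λ y → ∑[ x < y ] T x y) ⟩
  ∑[ y < n ] ∑[ x < y ] T x y ∎
  where open ≡-Reasoning

nonnegᵇ : ℤ → Bool
nonnegᵇ (+ _) = true
nonnegᵇ -[1+ _ ] = false

allNonneg : ∀ {N} → (Fin N → ℤ) → Bool
allNonneg {zero} v = true
allNonneg {suc N} v = nonnegᵇ (v Fin.zero) ∧ allNonneg (v ∘ Fin.suc)

-- `coeffℤ` scans `allFin N` with a local function; abstracting `allFin N` with `with`
-- exposes that function as the implicit argument of `scanner`.
coeffScan : ∀ {N} → Poly N → (Fin N → ℤ) → List (Fin N) → ℤ
coeffScan {N} f a = scanner abstracted
  where
  scanner : {G : List (Fin N) → ℤ} → ((∀ L → G L ≡ G L) → coeffℤ f a ≡ coeffℤ f a) → List (Fin N) → ℤ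
  scanner {G} _ = G
  abstracted : (∀ L → _ ≡ _) → coeffℤ f a ≡ coeffℤ f a
  abstracted h with allFin N
  ... | L = h L

coeffScan-tabulate : ∀ {M N} (f : Poly N) (a : Fin N → ℤ) (g : Fin M → Fin N) →
                     coeffScan f a (tabulate g) ≡ when (allNonneg (a ∘ g)) (f (λ i → ∣ a i ∣))
coeffScan-tabulate {zero} f a g = refl
coeffScan-tabulate {suc M} f a g with a (g Fin.zero)
... | + _ = coeffScan-tabulate f a (g ∘ Fin.suc)
... | -[1+ _ ] = refl

coeffℤ-char : ∀ {N} (f : Poly N) (a : Fin N → ℤ) → coeffℤ f a ≡ when (allNonneg a) (f (λ i → ∣ a i ∣))
coeffℤ-char f a = coeffScan-tabulate f a (λ i → i)

coeffℤ-cong : ∀ {N} (f : Poly N) → Congruent _≗_ _≡_ f → Congruent _≗_ _≡_ (coeffℤ f)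
coeffℤ-cong f f-cong {a} {b} a≗b = begin
  coeffℤ f a
    ≡⟨ coeffℤ-char f a ⟩
  when (allNonneg a) (f (λ i → ∣ a i ∣))
    ≡⟨ cong₂ when (allNonneg-cong a≗b) (f-cong (cong ∣_∣ ∘ a≗b)) ⟩
  when (allNonneg b) (f (λ i → ∣ b i ∣))
    ≡⟨ coeffℤ-char f b ⟨
  coeffℤ f b ∎
  where
  open ≡-Reasoning
  allNonneg-cong : ∀ {N} {a b : Fin N → ℤ} → a ≗ b → allNonneg a ≡ allNonneg b
  allNonneg-cong {zero} _ = refl
  allNonneg-cong {suc N} a≗b = cong₂ _∧_ (cong nonnegᵇ (a≗b Fin.zero)) (allNonneg-cong (a≗b ∘ Fin.suc))

_≡ᵛ_ : ∀ {N} → Mon N → Mon N → Bool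
_≡ᵛ_ {zero} α β = true
_≡ᵛ_ {suc N} α β = (α Fin.zero ≡ᵇ β Fin.zero) ∧ ((α ∘ Fin.suc) ≡ᵛ (β ∘ Fin.suc))

_≤ᵛ_ : ∀ {N} → Mon N → Mon N → Bool
_≤ᵛ_ {zero} α β = true
_≤ᵛ_ {suc N} α β = (α Fin.zero ≤ᵇ β Fin.zero) ∧ ((α ∘ Fin.suc) ≤ᵛ (β ∘ Fin.suc))

unit : ∀ {N} → Fin N → Mon N
unit i k = if k ≡ᶠ i then 1 else 0

pairMon : ∀ {N} → Fin N → Fin N → Mon N
pairMon i j k = unit i k ℕ.+ unit j k

elementary : ∀ {N} → ℕ → Poly N
elementary r α = ι (allLe1 α ∧ (sumMon α ≡ᵇ r))

elementary-0 : ∀ {N} (β : Mon N) → elementary 0 β ≡ ι (β ≡ᵛ (λ _ → 0))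
elementary-0 {zero} β = refl
elementary-0 {suc N} β with β Fin.zero
... | zero = elementary-0 (β ∘ Fin.suc)
... | suc zero = cong ι (Bool.∧-zeroʳ (allLe1 (β ∘ Fin.suc)))
... | suc (suc _) = refl

elementary-1 : ∀ {N} (β : Mon N) → elementary 1 β ≡ ∑ᶠ[ j ] ι (β ≡ᵛ unit j)
elementary-1 {zero} β = refl
elementary-1 {suc N} β with β Fin.zero
... | zero = trans (elementary-1 (β ∘ Fin.suc)) (sym (ℤ.+-identityˡ _))
... | suc zero = trans (elementary-0 (β ∘ Fin.suc)) (sym (+-vanishʳ (∑ᶠ-zero {N} (λ _ → refl))))
... | suc (suc _) = sym (∑ᶠ-zero {suc N} (λ _ → refl))

m11-pairs : ∀ {N} (β : Mon N) → m11 N β ≡ ∑⟨ i < j ⟩ ι (β ≡ᵛ pairMon i j)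
m11-pairs {zero} β = refl
m11-pairs {suc N} β = trans (split β) (sym (∑pairs-suc (λ i j → ι (β ≡ᵛ pairMon i j))))
  where
  split : ∀ β → m11 (suc N) β ≡ (∑ᶠ[ j ] ι (β ≡ᵛ pairMon Fin.zero (Fin.suc j)))
                                 + (∑⟨ i < j ⟩ ι (β ≡ᵛ pairMon (Fin.suc i) (Fin.suc j)))
  split β with β Fin.zero
  ... | zero = trans (m11-pairs (β ∘ Fin.suc)) (sym (+-vanishˡ (∑ᶠ-zero {N} (λ _ → refl))))
  ... | suc zero = trans (elementary-1 (β ∘ Fin.suc)) (sym (+-vanishʳ (∑pairs-zero {N} (λ _ _ → refl))))
  ... | suc (suc _) = sym (cong₂ _+_ (∑ᶠ-zero {N} (λ _ → refl)) (∑pairs-zero {N} (λ _ _ → refl)))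

<ᵇ-suc : ∀ c a → (c <ᵇ suc a) ≡ (c ≤ᵇ a)
<ᵇ-suc zero a = refl
<ᵇ-suc (suc c) a = refl

below-indicator : ∀ {N} (α γ : Mon N) (x : Mon N → ℤ) → Congruent _≗_ _≡_ x →
                  ∑[ β ∈ below α ] when (β ≡ᵛ γ) (x β) ≡ when (γ ≤ᵛ α) (x γ)
below-indicator {zero} α γ x x-cong = trans (ℤ.+-identityʳ _) (x-cong (λ ()))
below-indicator {suc N} α γ x x-cong = begin
  ∑[ β ∈ below α ] when (β ≡ᵛ γ) (x β)
    ≡⟨ ∑-concatMap _ (λ b → map (b ∷ᶠ_) (below α′)) (upTo (suc (α Fin.zero))) ⟩
  ∑[ b ∈ upTo (suc (α Fin.zero)) ] ∑[ β ∈ map (b ∷ᶠ_) (below α′) ] when (β ≡ᵛ γ) (x β)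
    ≡⟨ ∑-cong (λ b → trans (∑-map (λ β → when (β ≡ᵛ γ) (x β)) (b ∷ᶠ_) (below α′)) (tail-sum b))
              (upTo (suc (α Fin.zero))) ⟩
  ∑[ b ∈ upTo (suc (α Fin.zero)) ] when (b ≡ᵇ γ Fin.zero) (rest b)
    ≡⟨ ∑-applyUpTo (λ b → when (b ≡ᵇ γ Fin.zero) (rest b)) (λ t → t) (suc (α Fin.zero)) ⟩
  ∑[ t < suc (α Fin.zero) ] when (t ≡ᵇ γ Fin.zero) (rest t)
    ≡⟨ ∑<-indicator (suc (α Fin.zero)) (γ Fin.zero) rest ⟩
  when (γ Fin.zero <ᵇ suc (α Fin.zero)) (rest (γ Fin.zero))
    ≡⟨ cong₂ (λ b y → when b (when (γ′ ≤ᵛ α′) y))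
             (<ᵇ-suc (γ Fin.zero) (α Fin.zero)) (x-cong (∷-cong refl (λ _ → refl))) ⟩
  when (γ Fin.zero ≤ᵇ α Fin.zero) (when (γ′ ≤ᵛ α′) (x γ))
    ≡⟨ when-∧ (γ Fin.zero ≤ᵇ α Fin.zero) (γ′ ≤ᵛ α′) (x γ) ⟩
  when (γ ≤ᵛ α) (x γ) ∎
  where
  open ≡-Reasoning
  α′ γ′ : Mon N
  α′ = α ∘ Fin.suc
  γ′ = γ ∘ Fin.suc
  rest : ℕ → ℤ
  rest b = when (γ′ ≤ᵛ α′) (x (b ∷ᶠ γ′))
  tail-sum : ∀ b → ∑[ β ∈ below α′ ] when ((b ∷ᶠ β) ≡ᵛ γ) (x (b ∷ᶠ β))
                   ≡ when (b ≡ᵇ γ Fin.zero) (rest b)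
  tail-sum b = begin
    ∑[ β ∈ below α′ ] when ((b ≡ᵇ γ Fin.zero) ∧ (β ≡ᵛ γ′)) (x (b ∷ᶠ β))
      ≡⟨ ∑-cong (λ β → sym (when-∧ (b ≡ᵇ γ Fin.zero) (β ≡ᵛ γ′) _)) (below α′) ⟩
    ∑[ β ∈ below α′ ] when (b ≡ᵇ γ Fin.zero) (when (β ≡ᵛ γ′) (x (b ∷ᶠ β)))
      ≡⟨ ∑-when (b ≡ᵇ γ Fin.zero) _ (below α′) ⟩
    when (b ≡ᵇ γ Fin.zero) (∑[ β ∈ below α′ ] when (β ≡ᵛ γ′) (x (b ∷ᶠ β)))
      ≡⟨ cong (when (b ≡ᵇ γ Fin.zero))
              (below-indicator α′ γ′ (x ∘ (b ∷ᶠ_)) (x-cong ∘ ∷-cong refl)) ⟩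
    when (b ≡ᵇ γ Fin.zero) (rest b) ∎

mulP-m11 : ∀ {N} (g : Poly N) → Congruent _≗_ _≡_ g → ∀ α →
           mulP (m11 N) g α ≡ ∑⟨ i < j ⟩ when (pairMon i j ≤ᵛ α) (g (λ k → α k ∸ pairMon i j k))
mulP-m11 {N} g g-cong α = begin
  ∑[ β ∈ below α ] m11 N β * g (α ∸ᵐ β)
    ≡⟨ ∑-cong (λ β → trans (ℤ.*-comm (m11 N β) _) (cong (g (α ∸ᵐ β) *_) (m11-pairs β))) (below α) ⟩
  ∑[ β ∈ below α ] g (α ∸ᵐ β) * (∑⟨ i < j ⟩ ι (β ≡ᵛ pairMon i j))
    ≡⟨ ∑-cong (λ β → ∑pairs-*ˡ (g (α ∸ᵐ β)) (λ i j → ι (β ≡ᵛ pairMon i j))) (below α) ⟩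
  ∑[ β ∈ below α ] ∑⟨ i < j ⟩ g (α ∸ᵐ β) * ι (β ≡ᵛ pairMon i j)
    ≡⟨ ∑-cong (λ β → ∑pairs-cong (λ i j → *-ι (β ≡ᵛ pairMon i j) _)) (below α) ⟩
  ∑[ β ∈ below α ] ∑⟨ i < j ⟩ when (β ≡ᵛ pairMon i j) (g (α ∸ᵐ β))
    ≡⟨ ∑-∑pairs-comm (λ β i j → when (β ≡ᵛ pairMon i j) (g (α ∸ᵐ β))) (below α) ⟩
  ∑⟨ i < j ⟩ ∑[ β ∈ below α ] when (β ≡ᵛ pairMon i j) (g (α ∸ᵐ β))
    ≡⟨ ∑pairs-cong (λ i j → below-indicator α (pairMon i j) (g ∘ (α ∸ᵐ_))
                                            (λ β≗γ → g-cong (λ k → cong (α k ∸_) (β≗γ k)))) ⟩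
  ∑⟨ i < j ⟩ when (pairMon i j ≤ᵛ α) (g (α ∸ᵐ pairMon i j)) ∎
  where
  open ≡-Reasoning
  _∸ᵐ_ : Mon N → Mon N → Mon N
  (α ∸ᵐ β) k = α k ∸ β k

_-ᵛ_ : ∀ {N} → (Fin N → ℤ) → Mon N → (Fin N → ℤ)
(v -ᵛ u) k = v k - + u k

nonnegᵇ-⊖ : ∀ m n → nonnegᵇ (m ⊖ n) ≡ (n ≤ᵇ m)
nonnegᵇ-⊖ m zero = refl
nonnegᵇ-⊖ zero (suc n) = refl
nonnegᵇ-⊖ (suc m) (suc n) =
  trans (cong nonnegᵇ (ℤ.[1+m]⊖[1+n]≡m⊖n m n)) (trans (nonnegᵇ-⊖ m n) (sym (<ᵇ-suc n m)))

allNonneg-sub : ∀ {N} (v : Fin N → ℤ) (u : Mon N) → allNonneg v ≡ true →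
                allNonneg (v -ᵛ u) ≡ (u ≤ᵛ (λ k → ∣ v k ∣))
allNonneg-sub {zero} v u _ = refl
allNonneg-sub {suc N} v u v≥0 with v Fin.zero | v≥0
... | + m | v′≥0 = cong₂ _∧_ (trans (cong nonnegᵇ (ℤ.m-n≡m⊖n m (u Fin.zero))) (nonnegᵇ-⊖ m (u Fin.zero)))
                             (allNonneg-sub (v ∘ Fin.suc) (u ∘ Fin.suc) v′≥0)

allNonneg-sub-neg : ∀ {N} (v : Fin N → ℤ) (u : Mon N) → allNonneg v ≡ false → allNonneg (v -ᵛ u) ≡ false
allNonneg-sub-neg {suc N} v u v≱0 with v Fin.zero | v≱0
... | -[1+ m ] | _ = sub-neg (u Fin.zero)
  where
  sub-neg : ∀ n → nonnegᵇ (-[1+ m ] - + n) ∧ allNonneg ((v -ᵛ u) ∘ Fin.suc) ≡ false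
  sub-neg zero = refl
  sub-neg (suc n) = refl
... | + m | v′≱0 = trans (cong (_ ∧_) (allNonneg-sub-neg (v ∘ Fin.suc) (u ∘ Fin.suc) v′≱0)) (Bool.∧-zeroʳ _)

∧-trueˡ : ∀ {a b} → a ∧ b ≡ true → a ≡ true
∧-trueˡ {true} _ = refl

∧-trueʳ : ∀ {a b} → a ∧ b ≡ true → b ≡ true
∧-trueʳ {true} b≡true = b≡true

∣-ᵛ∣ : ∀ {N} (v : Fin N → ℤ) (u : Mon N) → allNonneg v ≡ true → (u ≤ᵛ (λ k → ∣ v k ∣)) ≡ true →
       ∀ k → ∣ (v -ᵛ u) k ∣ ≡ ∣ v k ∣ ∸ u k
∣-ᵛ∣ {suc N} v u v≥0 u≤v Fin.zero with v Fin.zero | v≥0 | u≤v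
... | + m | _ | u≤m∧ = trans (cong ∣_∣ (ℤ.m-n≡m⊖n m (u Fin.zero)))
                             (cong ∣_∣ (ℤ.⊖-≥ (ℕ.≤ᵇ⇒≤ (u Fin.zero) m
                                                         (subst T (sym (∧-trueˡ u≤m∧)) _))))
∣-ᵛ∣ {suc N} v u v≥0 u≤v (Fin.suc k) =
  ∣-ᵛ∣ (v ∘ Fin.suc) (u ∘ Fin.suc) (∧-trueʳ {nonnegᵇ (v Fin.zero)} v≥0)
       (∧-trueʳ {u Fin.zero ≤ᵇ ∣ v Fin.zero ∣} u≤v) k

coeffℤ-m11 : ∀ {N} (g : Poly N) → Congruent _≗_ _≡_ g → ∀ v →
             coeffℤ (mulP (m11 N) g) v ≡ ∑⟨ i < j ⟩ coeffℤ g (v -ᵛ pairMon i j)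
coeffℤ-m11 {N} g g-cong v = trans (coeffℤ-char (mulP (m11 N) g) v) (by-sign (allNonneg v) refl)
  where
  ∣v∣ : Mon N
  ∣v∣ k = ∣ v k ∣
  by-sign : ∀ b → allNonneg v ≡ b → when b (mulP (m11 N) g ∣v∣) ≡ ∑⟨ i < j ⟩ coeffℤ g (v -ᵛ pairMon i j)
  by-sign true v≥0 = trans (mulP-m11 g g-cong ∣v∣) (∑pairs-cong λ i j → sym (begin
    coeffℤ g (v -ᵛ pairMon i j)
      ≡⟨ coeffℤ-char g (v -ᵛ pairMon i j) ⟩
    when (allNonneg (v -ᵛ pairMon i j)) (g (λ k → ∣ (v -ᵛ pairMon i j) k ∣))
      ≡⟨ cong (λ b → when b (g (λ k → ∣ (v -ᵛ pairMon i j) k ∣))) (allNonneg-sub v (pairMon i j) v≥0) ⟩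
    when (pairMon i j ≤ᵛ ∣v∣) (g (λ k → ∣ (v -ᵛ pairMon i j) k ∣))
      ≡⟨ when-≡ (pairMon i j ≤ᵛ ∣v∣) (λ le → g-cong (∣-ᵛ∣ v (pairMon i j) v≥0 le)) ⟩
    when (pairMon i j ≤ᵛ ∣v∣) (g (λ k → ∣v∣ k ∸ pairMon i j k)) ∎))
    where open ≡-Reasoning
  by-sign false v≱0 = sym (∑pairs-zero λ i j →
    trans (coeffℤ-char g (v -ᵛ pairMon i j))
          (cong (λ b → when b (g (λ k → ∣ (v -ᵛ pairMon i j) k ∣))) (allNonneg-sub-neg v (pairMon i j) v≱0)))

mulP-cong : ∀ {N} (f g : Poly N) → Congruent _≗_ _≡_ g → Congruent _≗_ _≡_ (mulP f g)
mulP-cong f g g-cong {α} {α′} α≗α′ =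
  trans (cong (∑ (λ β → f β * g (λ k → α k ∸ β k))) (below-cong α≗α′))
        (∑-cong (λ β → cong (f β *_) (g-cong (λ k → cong (_∸ β k) (α≗α′ k)))) (below α′))
  where
  below-cong : ∀ {N} {α β : Mon N} → α ≗ β → below α ≡ below β
  below-cong {zero} _ = refl
  below-cong {suc N} α≗β = cong₂ (λ h B → concatMap (λ b → map (b ∷ᶠ_) B) (upTo (suc h)))
                                 (α≗β Fin.zero) (below-cong (α≗β ∘ Fin.suc))

oneP-cong : ∀ {N} → Congruent _≗_ _≡_ (oneP {N})
oneP-cong α≗β = cong (λ s → if s ≡ᵇ 0 then + 1 else + 0) (sumMon-cong α≗β)
  where
  sumMon-cong : ∀ {N} {α β : Mon N} → α ≗ β → sumMon α ≡ sumMon β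
  sumMon-cong {zero} _ = refl
  sumMon-cong {suc N} α≗β = cong₂ ℕ._+_ (α≗β Fin.zero) (sumMon-cong (α≗β ∘ Fin.suc))

powP-cong : ∀ {N} (f : Poly N) k → Congruent _≗_ _≡_ (powP f k)
powP-cong f zero = oneP-cong
powP-cong f (suc k) = mulP-cong f (powP f k) (powP-cong f k)

adjSwap : ∀ {M} → Fin M → Fin (suc M) → Fin (suc M)
adjSwap Fin.zero Fin.zero = Fin.suc Fin.zero
adjSwap Fin.zero (Fin.suc Fin.zero) = Fin.zero
adjSwap Fin.zero (Fin.suc (Fin.suc k)) = Fin.suc (Fin.suc k)
adjSwap (Fin.suc p) Fin.zero = Fin.zero
adjSwap (Fin.suc p) (Fin.suc k) = Fin.suc (adjSwap p k)

≡ᶠ-adjSwap : ∀ {M} (p : Fin M) i j → (adjSwap p i ≡ᶠ adjSwap p j) ≡ (i ≡ᶠ j)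
≡ᶠ-adjSwap Fin.zero Fin.zero Fin.zero = refl
≡ᶠ-adjSwap Fin.zero Fin.zero (Fin.suc Fin.zero) = refl
≡ᶠ-adjSwap Fin.zero Fin.zero (Fin.suc (Fin.suc j)) = refl
≡ᶠ-adjSwap Fin.zero (Fin.suc Fin.zero) Fin.zero = refl
≡ᶠ-adjSwap Fin.zero (Fin.suc Fin.zero) (Fin.suc Fin.zero) = refl
≡ᶠ-adjSwap Fin.zero (Fin.suc Fin.zero) (Fin.suc (Fin.suc j)) = refl
≡ᶠ-adjSwap Fin.zero (Fin.suc (Fin.suc i)) Fin.zero = refl
≡ᶠ-adjSwap Fin.zero (Fin.suc (Fin.suc i)) (Fin.suc Fin.zero) = refl
≡ᶠ-adjSwap Fin.zero (Fin.suc (Fin.suc i)) (Fin.suc (Fin.suc j)) = refl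
≡ᶠ-adjSwap (Fin.suc p) Fin.zero Fin.zero = refl
≡ᶠ-adjSwap (Fin.suc p) Fin.zero (Fin.suc j) = refl
≡ᶠ-adjSwap (Fin.suc p) (Fin.suc i) Fin.zero = refl
≡ᶠ-adjSwap (Fin.suc p) (Fin.suc i) (Fin.suc j) = ≡ᶠ-adjSwap p i j

∑ᶠ-adjSwap : ∀ {M} (p : Fin M) (f : Fin (suc M) → ℤ) → ∑ᶠ (f ∘ adjSwap p) ≡ ∑ᶠ f
∑ᶠ-adjSwap Fin.zero f = exchange (f (Fin.suc Fin.zero)) (f Fin.zero) _
  where
  exchange : ∀ a b c → a + (b + c) ≡ b + (a + c)
  exchange = solve-∀
∑ᶠ-adjSwap (Fin.suc p) f = cong (_+_ (f Fin.zero)) (∑ᶠ-adjSwap p (f ∘ Fin.suc))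

allNonneg-adjSwap : ∀ {M} (p : Fin M) (v : Fin (suc M) → ℤ) → allNonneg (v ∘ adjSwap p) ≡ allNonneg v
allNonneg-adjSwap Fin.zero v = exchange (nonnegᵇ (v (Fin.suc Fin.zero))) (nonnegᵇ (v Fin.zero)) _
  where
  exchange : ∀ a b c → a ∧ (b ∧ c) ≡ b ∧ (a ∧ c)
  exchange true b c = refl
  exchange false true c = refl
  exchange false false c = refl
allNonneg-adjSwap (Fin.suc p) v = cong (nonnegᵇ (v Fin.zero) ∧_) (allNonneg-adjSwap p (v ∘ Fin.suc))

sumMon-adjSwap : ∀ {M} (p : Fin M) (α : Mon (suc M)) → sumMon (α ∘ adjSwap p) ≡ sumMon α
sumMon-adjSwap Fin.zero α = exchange (α (Fin.suc Fin.zero)) (α Fin.zero) _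
  where
  exchange : ∀ a b c → a ℕ.+ (b ℕ.+ c) ≡ b ℕ.+ (a ℕ.+ c)
  exchange a b c = trans (sym (ℕ.+-assoc a b c)) (trans (cong (ℕ._+ c) (ℕ.+-comm a b)) (ℕ.+-assoc b a c))
sumMon-adjSwap (Fin.suc p) α = cong (α Fin.zero ℕ.+_) (sumMon-adjSwap p (α ∘ Fin.suc))

∑offDiagonal : ∀ {n} → (Fin n → Fin n → ℤ) → ℤ
∑offDiagonal T = ∑ᶠ[ i ] ∑ᶠ[ j ] when (not (i ≡ᶠ j)) (T i j)

∑offDiagonal-symmetric : ∀ {n} (T : Fin n → Fin n → ℤ) → (∀ i j → T i j ≡ T j i) →
                         ∑offDiagonal T ≡ ∑pairs T + ∑pairs T
∑offDiagonal-symmetric {n} T T-sym = begin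
  ∑ᶠ[ i ] ∑ᶠ[ j ] when (not (i ≡ᶠ j)) (T i j)
    ≡⟨ ∑ᶠ-cong (λ i → trans (∑ᶠ-cong (λ j → split (toℕ i) (toℕ j) (T i j)))
                            (∑ᶠ-+ (λ j → when (i <ᶠ j) (T i j)) (λ j → when (j <ᶠ i) (T i j)))) ⟩
  ∑ᶠ[ i ] ((∑ᶠ[ j ] when (i <ᶠ j) (T i j)) + (∑ᶠ[ j ] when (j <ᶠ i) (T i j)))
    ≡⟨ ∑ᶠ-+ (λ i → ∑ᶠ[ j ] when (i <ᶠ j) (T i j)) (λ i → ∑ᶠ[ j ] when (j <ᶠ i) (T i j)) ⟩
  ∑pairs T + ∑ᶠ {n} (λ i → ∑ᶠ[ j ] when (j <ᶠ i) (T i j))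
    ≡⟨ cong (_+_ (∑pairs T)) (trans (∑ᶠ-comm (λ i j → when (j <ᶠ i) (T i j)))
                                     (∑pairs-cong (λ j i → T-sym i j))) ⟩
  ∑pairs T + ∑pairs T ∎
  where
  open ≡-Reasoning
  split : ∀ a b x → when (not (a ≡ᵇ b)) x ≡ when (a <ᵇ b) x + when (b <ᵇ a) x
  split zero zero x = refl
  split zero (suc b) x = sym (ℤ.+-identityʳ x)
  split (suc a) zero x = sym (ℤ.+-identityˡ x)
  split (suc a) (suc b) x = split a b x

∑offDiagonal-adjSwap : ∀ {M} (p : Fin M) (T : Fin (suc M) → Fin (suc M) → ℤ) →
                       ∑offDiagonal (λ i j → T (adjSwap p i) (adjSwap p j)) ≡ ∑offDiagonal T
∑offDiagonal-adjSwap p T = begin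
  ∑ᶠ[ i ] ∑ᶠ[ j ] when (not (i ≡ᶠ j)) (T (adjSwap p i) (adjSwap p j))
    ≡⟨ ∑ᶠ-cong (λ i → ∑ᶠ-cong (λ j → cong (λ b → when (not b) (T (adjSwap p i) (adjSwap p j)))
                                          (sym (≡ᶠ-adjSwap p i j)))) ⟩
  ∑ᶠ[ i ] ∑ᶠ[ j ] when (not (adjSwap p i ≡ᶠ adjSwap p j)) (T (adjSwap p i) (adjSwap p j))
    ≡⟨ ∑ᶠ-cong (λ i → ∑ᶠ-adjSwap p (λ j → when (not (adjSwap p i ≡ᶠ j)) (T (adjSwap p i) j))) ⟩
  ∑ᶠ[ i ] ∑ᶠ[ j ] when (not (adjSwap p i ≡ᶠ j)) (T (adjSwap p i) j)
    ≡⟨ ∑ᶠ-adjSwap p (λ i → ∑ᶠ[ j ] when (not (i ≡ᶠ j)) (T i j)) ⟩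
  ∑offDiagonal T ∎
  where open ≡-Reasoning

-- The swap permutes the pairs {i, j} but does not preserve i < j; the off-diagonal sum, which
-- counts every pair twice, is invariant.
∑pairs-adjSwap : ∀ {M} (p : Fin M) (T : Fin (suc M) → Fin (suc M) → ℤ) → (∀ i j → T i j ≡ T j i) →
                 ∑⟨ i < j ⟩ T (adjSwap p i) (adjSwap p j) ≡ ∑pairs T
∑pairs-adjSwap p T T-sym = ℤ.*-cancelˡ-≡ (+ 2) (∑pairs T′) (∑pairs T) (begin
  + 2 * ∑pairs T′               ≡⟨ double (∑pairs T′) ⟩
  ∑pairs T′ + ∑pairs T′         ≡⟨ ∑offDiagonal-symmetric T′ (λ i j → T-sym (adjSwap p i) (adjSwap p j)) ⟨
  ∑offDiagonal T′               ≡⟨ ∑offDiagonal-adjSwap p T ⟩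
  ∑offDiagonal T                ≡⟨ ∑offDiagonal-symmetric T T-sym ⟩
  ∑pairs T + ∑pairs T           ≡⟨ double (∑pairs T) ⟨
  + 2 * ∑pairs T                ∎)
  where
  open ≡-Reasoning
  T′ : Fin _ → Fin _ → ℤ
  T′ i j = T (adjSwap p i) (adjSwap p j)
  double : ∀ x → + 2 * x ≡ x + x
  double = solve-∀

SwapInvariant : ∀ {M} → Poly (suc M) → Set
SwapInvariant f = ∀ p v → coeffℤ f (v ∘ adjSwap p) ≡ coeffℤ f v

oneP-swapInvariant : ∀ {M} → SwapInvariant (oneP {suc M})
oneP-swapInvariant p v = begin
  coeffℤ oneP (v ∘ adjSwap p)
    ≡⟨ coeffℤ-char oneP (v ∘ adjSwap p) ⟩
  when (allNonneg (v ∘ adjSwap p)) (oneP (λ k → ∣ v (adjSwap p k) ∣))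
    ≡⟨ cong₂ (λ b s → when b (if s ≡ᵇ 0 then + 1 else + 0))
             (allNonneg-adjSwap p v) (sumMon-adjSwap p (λ k → ∣ v k ∣)) ⟩
  when (allNonneg v) (oneP (λ k → ∣ v k ∣))
    ≡⟨ coeffℤ-char oneP v ⟨
  coeffℤ oneP v ∎
  where open ≡-Reasoning

mulP-m11-swapInvariant : ∀ {M} (g : Poly (suc M)) → Congruent _≗_ _≡_ g → SwapInvariant g →
                         SwapInvariant (mulP (m11 (suc M)) g)
mulP-m11-swapInvariant g g-cong g-inv p v = begin
  coeffℤ (mulP (m11 _) g) (v ∘ adjSwap p)
    ≡⟨ coeffℤ-m11 g g-cong (v ∘ adjSwap p) ⟩
  ∑⟨ i < j ⟩ coeffℤ g ((v ∘ adjSwap p) -ᵛ pairMon i j)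
    ≡⟨ ∑pairs-cong (λ i j → trans (coeffℤ-cong g g-cong (relabel i j))
                                  (g-inv p (v -ᵛ pairMon (adjSwap p i) (adjSwap p j)))) ⟩
  ∑⟨ i < j ⟩ lowered (adjSwap p i) (adjSwap p j)
    ≡⟨ ∑pairs-adjSwap p lowered (λ i j → coeffℤ-cong g g-cong
         (λ k → cong (λ u → v k - + u) (ℕ.+-comm (unit i k) (unit j k)))) ⟩
  ∑pairs lowered
    ≡⟨ coeffℤ-m11 g g-cong v ⟨
  coeffℤ (mulP (m11 _) g) v ∎
  where
  open ≡-Reasoning
  lowered : Fin _ → Fin _ → ℤ
  lowered i j = coeffℤ g (v -ᵛ pairMon i j)
  unit-adjSwap : ∀ i k → unit (adjSwap p i) (adjSwap p k) ≡ unit i k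
  unit-adjSwap i k = cong (λ b → if b then 1 else 0) (≡ᶠ-adjSwap p k i)
  relabel : ∀ i j → (v ∘ adjSwap p) -ᵛ pairMon i j ≗ (v -ᵛ pairMon (adjSwap p i) (adjSwap p j)) ∘ adjSwap p
  relabel i j k = cong (λ u → v (adjSwap p k) - + u) (sym (cong₂ ℕ._+_ (unit-adjSwap i k) (unit-adjSwap j k)))

m11-power-swapInvariant : ∀ {M} k → SwapInvariant (powP (m11 (suc M)) k)
m11-power-swapInvariant zero = oneP-swapInvariant
m11-power-swapInvariant {M} (suc k) =
  mulP-m11-swapInvariant (powP (m11 (suc M)) k) (powP-cong (m11 (suc M)) k) (m11-power-swapInvariant k)

∏ᶠ : ∀ {n} → (Fin n → ℤ) → ℤ
∏ᶠ {zero} f = + 1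
∏ᶠ {suc n} f = f Fin.zero * ∏ᶠ (f ∘ Fin.suc)

∏ᶠ-cong : ∀ {n} {f g : Fin n → ℤ} → f ≗ g → ∏ᶠ f ≡ ∏ᶠ g
∏ᶠ-cong {zero} _ = refl
∏ᶠ-cong {suc n} f≗g = cong₂ _*_ (f≗g Fin.zero) (∏ᶠ-cong (f≗g ∘ Fin.suc))

∏ᶠ-one : ∀ {n} {f : Fin n → ℤ} → (∀ i → f i ≡ + 1) → ∏ᶠ f ≡ + 1
∏ᶠ-one {zero} _ = refl
∏ᶠ-one {suc n} f≡1 = cong₂ _*_ (f≡1 Fin.zero) (∏ᶠ-one (f≡1 ∘ Fin.suc))

∏ᶠ-adjSwap : ∀ {M} (p : Fin M) (f : Fin (suc M) → ℤ) → ∏ᶠ (f ∘ adjSwap p) ≡ ∏ᶠ f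
∏ᶠ-adjSwap Fin.zero f = exchange (f (Fin.suc Fin.zero)) (f Fin.zero) _
  where
  exchange : ∀ a b c → a * (b * c) ≡ b * (a * c)
  exchange = solve-∀
∏ᶠ-adjSwap (Fin.suc p) f = cong (f Fin.zero *_) (∏ᶠ-adjSwap p (f ∘ Fin.suc))

prodℤ-allFin : ∀ {n} (f : Fin n → ℤ) → prodℤ (map f (allFin n)) ≡ ∏ᶠ f
prodℤ-allFin f = trans (cong prodℤ (List.map-tabulate (λ i → i) f)) (prod-tabulate f)
  where
  prod-tabulate : ∀ {n} (f : Fin n → ℤ) → prodℤ (tabulate f) ≡ ∏ᶠ f
  prod-tabulate {zero} f = refl
  prod-tabulate {suc n} f = cong (f Fin.zero *_) (prod-tabulate (f ∘ Fin.suc))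

prodℤ-concatMap : ∀ {A : Set} (g : A → List ℤ) xs → prodℤ (concatMap g xs) ≡ prodℤ (map (prodℤ ∘ g) xs)
prodℤ-concatMap g [] = refl
prodℤ-concatMap g (x ∷ xs) = trans (prodℤ-++ (g x) (concatMap g xs)) (cong (prodℤ (g x) *_) (prodℤ-concatMap g xs))
  where
  prodℤ-++ : ∀ xs ys → prodℤ (xs ++ ys) ≡ prodℤ xs * prodℤ ys
  prodℤ-++ [] ys = sym (ℤ.*-identityˡ _)
  prodℤ-++ (x ∷ xs) ys = trans (cong (x *_) (prodℤ-++ xs ys)) (sym (ℤ.*-assoc x _ _))

sgnℤ-anti : ∀ x y → sgnℤ (x - y) ≡ - sgnℤ (y - x)
sgnℤ-anti x y = trans (cong sgnℤ (flip x y)) (sgnℤ-neg (y - x))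
  where
  flip : ∀ x y → x - y ≡ - (y - x)
  flip = solve-∀
  sgnℤ-neg : ∀ z → sgnℤ (- z) ≡ - sgnℤ z
  sgnℤ-neg (+ zero) = refl
  sgnℤ-neg (+ suc n) = refl
  sgnℤ-neg -[1+ n ] = refl

inversionSign : ∀ {N} → (Fin N → ℕ) → ℤ
inversionSign {zero} u = + 1
inversionSign {suc N} u = ∏ᶠ (λ j → sgnℤ (+ u (Fin.suc j) - + u Fin.zero)) * inversionSign (u ∘ Fin.suc)

sgn-inversionSign : ∀ {N} (τ : Fin N → Fin N) → sgn τ ≡ inversionSign (toℕ ∘ τ)
sgn-inversionSign {N} τ = begin
  sgn τ
    ≡⟨ prodℤ-concatMap (λ i → map (factor (toℕ ∘ τ) i) (allFin N)) (allFin N) ⟩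
  prodℤ (map (λ i → prodℤ (map (factor (toℕ ∘ τ) i) (allFin N))) (allFin N))
    ≡⟨ cong prodℤ (List.map-cong (λ i → prodℤ-allFin (factor (toℕ ∘ τ) i)) (allFin N)) ⟩
  prodℤ (map (λ i → ∏ᶠ (factor (toℕ ∘ τ) i)) (allFin N))
    ≡⟨ prodℤ-allFin (λ i → ∏ᶠ (factor (toℕ ∘ τ) i)) ⟩
  ∏ᶠ (λ i → ∏ᶠ (factor (toℕ ∘ τ) i))
    ≡⟨ unfold (toℕ ∘ τ) ⟩
  inversionSign (toℕ ∘ τ) ∎
  where
  open ≡-Reasoning
  factor : ∀ {N} → (Fin N → ℕ) → Fin N → Fin N → ℤ
  factor u i j = if i <ᶠ j then sgnℤ (+ u j - + u i) else + 1
  unfold : ∀ {N} (u : Fin N → ℕ) → ∏ᶠ (λ i → ∏ᶠ (factor u i)) ≡ inversionSign u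
  unfold {zero} u = refl
  unfold {suc N} u =
    cong₂ _*_ (ℤ.*-identityˡ (∏ᶠ (λ j → sgnℤ (+ u (Fin.suc j) - + u Fin.zero))))
              (trans (∏ᶠ-cong (λ i → ℤ.*-identityˡ (∏ᶠ (factor (u ∘ Fin.suc) i)))) (unfold (u ∘ Fin.suc)))

inversionSign-cong : ∀ {N} {u w : Fin N → ℕ} → u ≗ w → inversionSign u ≡ inversionSign w
inversionSign-cong {zero} _ = refl
inversionSign-cong {suc N} u≗w =
  cong₂ _*_ (∏ᶠ-cong (λ j → cong₂ (λ a b → sgnℤ (+ a - + b)) (u≗w (Fin.suc j)) (u≗w Fin.zero)))
            (inversionSign-cong (u≗w ∘ Fin.suc))

inversionSign-adjSwap : ∀ {M} (p : Fin M) (u : Fin (suc M) → ℕ) → inversionSign (u ∘ adjSwap p) ≡ - inversionSign u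
inversionSign-adjSwap {suc M} Fin.zero u =
  trans (cong (λ s → s * A₁ * (A₀ * rest)) (sgnℤ-anti (+ u Fin.zero) (+ u (Fin.suc Fin.zero))))
        (rearrange (sgnℤ (+ u (Fin.suc Fin.zero) - + u Fin.zero)) A₀ A₁ rest)
  where
  A₀ A₁ rest : ℤ
  A₀ = ∏ᶠ (λ j → sgnℤ (+ u (Fin.suc (Fin.suc j)) - + u Fin.zero))
  A₁ = ∏ᶠ (λ j → sgnℤ (+ u (Fin.suc (Fin.suc j)) - + u (Fin.suc Fin.zero)))
  rest = inversionSign (u ∘ Fin.suc ∘ Fin.suc)
  rearrange : ∀ s a b r → - s * b * (a * r) ≡ - (s * a * (b * r))
  rearrange = solve-∀
inversionSign-adjSwap {suc M} (Fin.suc p) u =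
  trans (cong₂ _*_ (∏ᶠ-adjSwap p (λ j → sgnℤ (+ u (Fin.suc j) - + u Fin.zero)))
                   (inversionSign-adjSwap p (u ∘ Fin.suc)))
        (sym (ℤ.neg-distribʳ-* (∏ᶠ (λ j → sgnℤ (+ u (Fin.suc j) - + u Fin.zero))) (inversionSign (u ∘ Fin.suc))))

inversionSign-increasing : ∀ {N} s (u : Fin N → ℕ) → (∀ q → u q ≡ s ℕ.+ toℕ q) → inversionSign u ≡ + 1
inversionSign-increasing {zero} s u _ = refl
inversionSign-increasing {suc N} s u u≡ = cong₂ _*_
  (∏ᶠ-one (λ j → trans (cong₂ (λ a b → sgnℤ (+ a - + b))
                              (u≡ (Fin.suc j)) (trans (u≡ Fin.zero) (ℕ.+-identityʳ s)))
                       (positive s (toℕ j))))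
  (inversionSign-increasing (suc s) (u ∘ Fin.suc) (λ q → trans (u≡ (Fin.suc q)) (ℕ.+-suc s (toℕ q))))
  where
  positive : ∀ a d → sgnℤ (+ (a ℕ.+ suc d) - + a) ≡ + 1
  positive a d = cong sgnℤ (trans (cong (_- + a) (ℤ.pos-+ a (suc d))) (cancel (+ a) (+ suc d)))
    where
    cancel : ∀ x y → x + y - x ≡ y
    cancel = solve-∀

sgn-cong : ∀ {N} {τ τ′ : Fin N → Fin N} → τ ≗ τ′ → sgn τ ≡ sgn τ′
sgn-cong {τ = τ} {τ′} τ≗τ′ =
  trans (sgn-inversionSign τ) (trans (inversionSign-cong (cong toℕ ∘ τ≗τ′)) (sym (sgn-inversionSign τ′)))

sgn-adjSwap : ∀ {M} (p : Fin M) (τ : Fin (suc M) → Fin (suc M)) → sgn (τ ∘ adjSwap p) ≡ - sgn τ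
sgn-adjSwap p τ =
  trans (sgn-inversionSign (τ ∘ adjSwap p))
        (trans (inversionSign-adjSwap p (toℕ ∘ τ)) (cong -_ (sym (sgn-inversionSign τ))))

sgn-id : ∀ N → sgn {N} (λ q → q) ≡ + 1
sgn-id N = trans (sgn-inversionSign {N} (λ q → q)) (inversionSign-increasing {N} 0 toℕ (λ _ → refl))

∑-allMaps-suc : ∀ N K (h : (Fin (suc N) → Fin K) → ℤ) →
                ∑ h (allMaps (suc N) K) ≡ ∑ᶠ[ t ] ∑[ τ ∈ allMaps N K ] h (t ∷ᶠ τ)
∑-allMaps-suc N K h =
  trans (∑-concatMap h (λ t → map (t ∷ᶠ_) (allMaps N K)) (allFin K))
        (trans (∑-cong (λ t → ∑-map h (t ∷ᶠ_) (allMaps N K)) (allFin K))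
               (∑-allFin (λ t → ∑[ τ ∈ allMaps N K ] h (t ∷ᶠ τ))))

∑-allMaps-adjSwap : ∀ {M K} (p : Fin M) (h : (Fin (suc M) → Fin K) → ℤ) → Congruent _≗_ _≡_ h →
                    ∑[ τ ∈ allMaps (suc M) K ] h (τ ∘ adjSwap p) ≡ ∑ h (allMaps (suc M) K)
∑-allMaps-adjSwap {suc M} {K} Fin.zero h h-cong = begin
  ∑[ τ ∈ allMaps (suc (suc M)) K ] h (τ ∘ adjSwap Fin.zero)
    ≡⟨ unfold₂ (λ τ → h (τ ∘ adjSwap Fin.zero)) ⟩
  ∑ᶠ[ t₀ ] ∑ᶠ[ t₁ ] ∑[ τ ∈ allMaps M K ] h ((t₀ ∷ᶠ (t₁ ∷ᶠ τ)) ∘ adjSwap Fin.zero)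
    ≡⟨ ∑ᶠ-cong (λ t₀ → ∑ᶠ-cong (λ t₁ →
         ∑-cong (λ τ → h-cong (swapped t₀ t₁ τ)) (allMaps M K))) ⟩
  ∑ᶠ[ t₀ ] ∑ᶠ[ t₁ ] ∑[ τ ∈ allMaps M K ] h (t₁ ∷ᶠ (t₀ ∷ᶠ τ))
    ≡⟨ ∑ᶠ-comm (λ t₀ t₁ → ∑[ τ ∈ allMaps M K ] h (t₁ ∷ᶠ (t₀ ∷ᶠ τ))) ⟩
  ∑ᶠ[ t₁ ] ∑ᶠ[ t₀ ] ∑[ τ ∈ allMaps M K ] h (t₁ ∷ᶠ (t₀ ∷ᶠ τ))
    ≡⟨ unfold₂ h ⟨
  ∑ h (allMaps (suc (suc M)) K) ∎
  where
  open ≡-Reasoning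
  unfold₂ : ∀ (g : (Fin (suc (suc M)) → Fin K) → ℤ) →
            ∑ g (allMaps (suc (suc M)) K)
            ≡ ∑ᶠ[ t₀ ] ∑ᶠ[ t₁ ] ∑[ τ ∈ allMaps M K ] g (t₀ ∷ᶠ (t₁ ∷ᶠ τ))
  unfold₂ g = trans (∑-allMaps-suc (suc M) K g)
                    (∑ᶠ-cong (λ t₀ → ∑-allMaps-suc M K (λ τ → g (t₀ ∷ᶠ τ))))
  swapped : ∀ t₀ t₁ (τ : Fin M → Fin K) →
            (t₀ ∷ᶠ (t₁ ∷ᶠ τ)) ∘ adjSwap Fin.zero ≗ t₁ ∷ᶠ (t₀ ∷ᶠ τ)
  swapped t₀ t₁ τ Fin.zero = refl
  swapped t₀ t₁ τ (Fin.suc Fin.zero) = refl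
  swapped t₀ t₁ τ (Fin.suc (Fin.suc k)) = refl
∑-allMaps-adjSwap {suc M} {K} (Fin.suc p) h h-cong = begin
  ∑[ τ ∈ allMaps (suc (suc M)) K ] h (τ ∘ adjSwap (Fin.suc p))
    ≡⟨ ∑-allMaps-suc (suc M) K (λ τ → h (τ ∘ adjSwap (Fin.suc p))) ⟩
  ∑ᶠ[ t ] ∑[ τ ∈ allMaps (suc M) K ] h ((t ∷ᶠ τ) ∘ adjSwap (Fin.suc p))
    ≡⟨ ∑ᶠ-cong (λ t → trans (∑-cong (λ τ → h-cong (swapped t τ)) (allMaps (suc M) K))
                            (∑-allMaps-adjSwap p (h ∘ (t ∷ᶠ_)) (h-cong ∘ ∷-cong refl))) ⟩
  ∑ᶠ[ t ] ∑[ τ ∈ allMaps (suc M) K ] h (t ∷ᶠ τ)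
    ≡⟨ ∑-allMaps-suc (suc M) K h ⟨
  ∑ h (allMaps (suc (suc M)) K) ∎
  where
  open ≡-Reasoning
  swapped : ∀ t (τ : Fin (suc M) → Fin K) → (t ∷ᶠ τ) ∘ adjSwap (Fin.suc p) ≗ t ∷ᶠ (τ ∘ adjSwap p)
  swapped t τ Fin.zero = refl
  swapped t τ (Fin.suc k) = refl

_≡ᵐ_ : ∀ {N K} → (Fin N → Fin K) → (Fin N → Fin K) → Bool
_≡ᵐ_ {zero} τ σ = true
_≡ᵐ_ {suc N} τ σ = (τ Fin.zero ≡ᶠ σ Fin.zero) ∧ ((τ ∘ Fin.suc) ≡ᵐ (σ ∘ Fin.suc))

∑-allMaps-point : ∀ {N K} (σ : Fin N → Fin K) (h : (Fin N → Fin K) → ℤ) → Congruent _≗_ _≡_ h →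
                  ∑[ τ ∈ allMaps N K ] when (τ ≡ᵐ σ) (h τ) ≡ h σ
∑-allMaps-point {zero} σ h h-cong = trans (ℤ.+-identityʳ _) (h-cong (λ ()))
∑-allMaps-point {suc N} {K} σ h h-cong = begin
  ∑[ τ ∈ allMaps (suc N) K ] when (τ ≡ᵐ σ) (h τ)
    ≡⟨ ∑-allMaps-suc N K (λ τ → when (τ ≡ᵐ σ) (h τ)) ⟩
  ∑ᶠ[ t ] ∑[ τ ∈ allMaps N K ] when ((t ≡ᶠ σ Fin.zero) ∧ (τ ≡ᵐ (σ ∘ Fin.suc))) (h (t ∷ᶠ τ))
    ≡⟨ ∑ᶠ-cong (λ t → trans (∑-cong (λ τ → sym (when-∧ (t ≡ᶠ σ Fin.zero) _ _)) (allMaps N K))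
                    (trans (∑-when (t ≡ᶠ σ Fin.zero) (λ τ → when (τ ≡ᵐ (σ ∘ Fin.suc)) (h (t ∷ᶠ τ)))
                                   (allMaps N K))
                           (cong (when (t ≡ᶠ σ Fin.zero))
                                 (∑-allMaps-point (σ ∘ Fin.suc) (h ∘ (t ∷ᶠ_)) (h-cong ∘ ∷-cong refl))))) ⟩
  ∑ᶠ[ t ] when (t ≡ᶠ σ Fin.zero) (h (t ∷ᶠ (σ ∘ Fin.suc)))
    ≡⟨ ∑ᶠ-indicator (σ Fin.zero) (λ t → h (t ∷ᶠ (σ ∘ Fin.suc))) ⟩
  h (σ Fin.zero ∷ᶠ (σ ∘ Fin.suc))
    ≡⟨ h-cong (∷-cong refl (λ _ → refl)) ⟩
  h σ ∎
  where open ≡-Reasoning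

jtExponent : ∀ {N} → (ℕ → ℤ) → (Fin N → Fin N) → Fin N → ℤ
jtExponent μ τ i = μ (toℕ i) - + toℕ i + + toℕ (τ i)

hallSchurℤ : (N : ℕ) → Poly N → (ℕ → ℤ) → ℤ
hallSchurℤ N f μ = ∑[ τ ∈ allMaps N N ] sgn τ * coeffℤ f (jtExponent μ τ)

hallSchurℤ-cong : ∀ N (f : Poly N) → Congruent _≗_ _≡_ f → ∀ {μ ν : ℕ → ℤ} →
                  (∀ (i : Fin N) → μ (toℕ i) ≡ ν (toℕ i)) → hallSchurℤ N f μ ≡ hallSchurℤ N f ν
hallSchurℤ-cong N f f-cong μ≡ν = ∑-cong (λ τ → cong (sgn τ *_) (coeffℤ-cong f f-cong
  (λ i → cong (λ m → m - + toℕ i + + toℕ (τ i)) (μ≡ν i)))) (allMaps N N)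

lowerRows : ℕ → ℕ → (ℕ → ℤ) → (ℕ → ℤ)
lowerRows x y μ t = μ t - (ι (t ≡ᵇ x) + ι (t ≡ᵇ y))

hallSchurℤ-m11 : ∀ N (g : Poly N) → Congruent _≗_ _≡_ g → ∀ μ →
                 hallSchurℤ N (mulP (m11 N) g) μ ≡ ∑[ y < N ] ∑[ x < y ] hallSchurℤ N g (lowerRows x y μ)
hallSchurℤ-m11 N g g-cong μ = begin
  ∑[ τ ∈ allMaps N N ] sgn τ * coeffℤ (mulP (m11 N) g) (jtExponent μ τ)
    ≡⟨ ∑-cong (λ τ → cong (sgn τ *_) (coeffℤ-m11 g g-cong (jtExponent μ τ))) (allMaps N N) ⟩
  ∑[ τ ∈ allMaps N N ] sgn τ * (∑⟨ i < j ⟩ coeffℤ g (jtExponent μ τ -ᵛ pairMon i j))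
    ≡⟨ ∑-cong (λ τ → ∑pairs-*ˡ (sgn τ) (λ i j → coeffℤ g (jtExponent μ τ -ᵛ pairMon i j)))
              (allMaps N N) ⟩
  ∑[ τ ∈ allMaps N N ] ∑⟨ i < j ⟩ sgn τ * coeffℤ g (jtExponent μ τ -ᵛ pairMon i j)
    ≡⟨ ∑-∑pairs-comm (λ τ i j → sgn τ * coeffℤ g (jtExponent μ τ -ᵛ pairMon i j)) (allMaps N N) ⟩
  ∑⟨ i < j ⟩ ∑[ τ ∈ allMaps N N ] sgn τ * coeffℤ g (jtExponent μ τ -ᵛ pairMon i j)
    ≡⟨ ∑pairs-cong (λ i j → ∑-cong (λ τ → cong (sgn τ *_) (coeffℤ-cong g g-cong (λ k →
         trans (reassociate (μ (toℕ k)) (+ toℕ k) (+ toℕ (τ k)) (+ pairMon i j k))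
               (cong (λ d → μ (toℕ k) - d - + toℕ k + + toℕ (τ k)) (pairMon-ι i j k))))) (allMaps N N)) ⟩
  ∑pairs {N} (λ i j → hallSchurℤ N g (lowerRows (toℕ i) (toℕ j) μ))
    ≡⟨ ∑pairs-toℕ {N} (λ x y → hallSchurℤ N g (lowerRows x y μ)) ⟩
  ∑[ y < N ] ∑[ x < y ] hallSchurℤ N g (lowerRows x y μ) ∎
  where
  open ≡-Reasoning
  reassociate : ∀ m k t u → m - k + t - u ≡ m - u - k + t
  reassociate = solve-∀
  pairMon-ι : ∀ i j k → + pairMon i j k ≡ ι (toℕ k ≡ᵇ toℕ i) + ι (toℕ k ≡ᵇ toℕ j)
  pairMon-ι i j k = trans (ℤ.pos-+ (unit i k) (unit j k)) (cong₂ _+_ (ι-pos (k ≡ᶠ i)) (ι-pos (k ≡ᶠ j)))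

toℕ-adjSwap : ∀ {M} (q : Fin M) (g : ℕ → ℤ) → g (toℕ q) ≡ g (suc (toℕ q)) →
              ∀ k → g (toℕ (adjSwap q k)) ≡ g (toℕ k)
toℕ-adjSwap Fin.zero g g≡ Fin.zero = sym g≡
toℕ-adjSwap Fin.zero g g≡ (Fin.suc Fin.zero) = g≡
toℕ-adjSwap Fin.zero g g≡ (Fin.suc (Fin.suc k)) = refl
toℕ-adjSwap (Fin.suc q) g g≡ Fin.zero = refl
toℕ-adjSwap (Fin.suc q) g g≡ (Fin.suc k) = toℕ-adjSwap q (g ∘ suc) g≡ k

self-negating : ∀ x → x ≡ - x → x ≡ + 0
self-negating (+ zero) _ = refl

-- Precomposing τ with the transposition of p and p + 1 negates sgn τ and, since
-- μ (p + 1) = μ p + 1, only permutes the exponent: the sum equals its own negative.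
hallSchurℤ-straighten : ∀ {M} (f : Poly (suc M)) → Congruent _≗_ _≡_ f → SwapInvariant f →
                        ∀ μ p → suc p < suc M → μ (suc p) ≡ μ p + + 1 → hallSchurℤ (suc M) f μ ≡ + 0
hallSchurℤ-straighten {M} f f-cong f-inv μ p (s≤s p<M) μ-step =
  self-negating _ (trans (sym (∑-allMaps-adjSwap q term term-cong))
                         (trans (∑-cong term-adjSwap (allMaps (suc M) (suc M))) (∑-neg term (allMaps (suc M) (suc M)))))
  where
  q : Fin M
  q = Fin.fromℕ< p<M
  c : Fin (suc M) → ℤ
  c i = μ (toℕ i) - + toℕ i
  term : (Fin (suc M) → Fin (suc M)) → ℤ
  term τ = sgn τ * coeffℤ f (jtExponent μ τ)
  term-cong : Congruent _≗_ _≡_ term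
  term-cong τ≗τ′ =
    cong₂ _*_ (sgn-cong τ≗τ′) (coeffℤ-cong f f-cong (λ i → cong (λ t → c i + + toℕ t) (τ≗τ′ i)))
  shift-step : ∀ m → m - + p ≡ m + + 1 - + suc p
  shift-step m = trans (cancel m (+ p)) (cong (λ z → m + + 1 - z) (sym (ℤ.pos-+ 1 p)))
    where
    cancel : ∀ m p → m - p ≡ m + + 1 - (+ 1 + p)
    cancel = solve-∀
  c-adjSwap : ∀ k → c (adjSwap q k) ≡ c k
  c-adjSwap = toℕ-adjSwap q (λ t → μ t - + t)
    (subst (λ t → μ t - + t ≡ μ (suc t) - + suc t) (sym (toℕ-fromℕ< p<M))
           (trans (shift-step (μ p)) (cong (λ m → m - + suc p) (sym μ-step))))
  term-adjSwap : ∀ τ → term (τ ∘ adjSwap q) ≡ - term τ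
  term-adjSwap τ = trans (cong₂ _*_ (sgn-adjSwap q τ)
    (trans (coeffℤ-cong f f-cong (λ k → cong (_+ + toℕ (τ (adjSwap q k))) (sym (c-adjSwap k))))
           (f-inv q (λ i → c i + + toℕ (τ i)))))
    (sym (ℤ.neg-distribˡ-* (sgn τ) _))

allNonneg-false : ∀ {N} (v : Fin N → ℤ) q → nonnegᵇ (v q) ≡ false → allNonneg v ≡ false
allNonneg-false v Fin.zero vq<0 = cong (_∧ allNonneg (v ∘ Fin.suc)) vq<0
allNonneg-false v (Fin.suc q) vq<0 =
  trans (cong (nonnegᵇ (v Fin.zero) ∧_) (allNonneg-false (v ∘ Fin.suc) q vq<0)) (Bool.∧-zeroʳ (nonnegᵇ (v Fin.zero)))

-- The exponent of row y is -1 - y + τ y < 0 for every τ.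
hallSchurℤ-lastRow : ∀ N (f : Poly N) μ y → suc y ≡ N → μ y ≡ -[1+ 0 ] → hallSchurℤ N f μ ≡ + 0
hallSchurℤ-lastRow .(suc y) f μ y refl μy≡-1 = ∑-zero (λ τ →
  trans (cong (sgn τ *_) (trans (coeffℤ-char f (jtExponent μ τ))
          (cong (λ b → when b (f (λ i → ∣ jtExponent μ τ i ∣)))
                (allNonneg-false (jtExponent μ τ) (Fin.fromℕ y) (negative (τ (Fin.fromℕ y)))))))
        (ℤ.*-zeroʳ (sgn τ))) (allMaps (suc y) (suc y))
  where
  -1-y≡ : ∀ y → -[1+ 0 ] - + y ≡ -[1+ y ]
  -1-y≡ zero = refl
  -1-y≡ (suc y) = refl
  negative : ∀ (t : Fin (suc y)) → nonnegᵇ (μ (toℕ (Fin.fromℕ y)) - + toℕ (Fin.fromℕ y) + + toℕ t) ≡ false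
  negative t rewrite toℕ-fromℕ y | μy≡-1 | -1-y≡ y =
    trans (nonnegᵇ-⊖ (toℕ t) (suc y)) (<ᵇ-false (ℕ.≤-pred (toℕ<n t)))

isZeroᵇ : ℤ → Bool
isZeroᵇ (+ zero) = true
isZeroᵇ (+ suc _) = false
isZeroᵇ -[1+ _ ] = false

allZero : ∀ {N} → (Fin N → ℤ) → Bool
allZero {zero} v = true
allZero {suc N} v = isZeroᵇ (v Fin.zero) ∧ allZero (v ∘ Fin.suc)

coeffℤ-oneP : ∀ {N} (v : Fin N → ℤ) → coeffℤ oneP v ≡ ι (allZero v)
coeffℤ-oneP v = trans (coeffℤ-char oneP v) (by-entries v)
  where
  by-entries : ∀ {N} (v : Fin N → ℤ) → when (allNonneg v) (oneP (λ i → ∣ v i ∣)) ≡ ι (allZero v)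
  by-entries {zero} v = refl
  by-entries {suc N} v with v Fin.zero
  ... | + zero = by-entries (v ∘ Fin.suc)
  ... | + suc m = when-zero (allNonneg (v ∘ Fin.suc))
  ... | -[1+ m ] = refl

allZero-shift : ∀ {N K} (σ τ : Fin N → Fin K) →
                allZero (λ q → + 0 - + toℕ (σ q) + + toℕ (τ q)) ≡ (τ ≡ᵐ σ)
allZero-shift {zero} σ τ = refl
allZero-shift {suc N} σ τ =
  cong₂ _∧_ (entry (toℕ (σ Fin.zero)) (toℕ (τ Fin.zero))) (allZero-shift (σ ∘ Fin.suc) (τ ∘ Fin.suc))
  where
  isZeroᵇ-⊖ : ∀ b a → isZeroᵇ (b ⊖ a) ≡ (b ≡ᵇ a)
  isZeroᵇ-⊖ zero zero = refl
  isZeroᵇ-⊖ (suc b) zero = refl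
  isZeroᵇ-⊖ zero (suc a) = refl
  isZeroᵇ-⊖ (suc b) (suc a) = trans (cong isZeroᵇ (ℤ.[1+m]⊖[1+n]≡m⊖n b a)) (isZeroᵇ-⊖ b a)
  reorder : ∀ x y → + 0 - x + y ≡ y - x
  reorder = solve-∀
  entry : ∀ a b → isZeroᵇ (+ 0 - + a + + b) ≡ (b ≡ᵇ a)
  entry a b = trans (cong isZeroᵇ (trans (reorder (+ a) (+ b)) (ℤ.m-n≡m⊖n b a))) (isZeroᵇ-⊖ b a)

hallSchurℤ-oneP : ∀ N → hallSchurℤ N oneP (λ _ → + 0) ≡ + 1
hallSchurℤ-oneP N = begin
  ∑[ τ ∈ allMaps N N ] sgn τ * coeffℤ oneP (jtExponent (λ _ → + 0) τ)
    ≡⟨ ∑-cong (λ τ → trans (cong (sgn τ *_) (trans (coeffℤ-oneP (jtExponent (λ _ → + 0) τ))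
                                                   (cong ι (allZero-shift (λ i → i) τ))))
                           (*-ι (τ ≡ᵐ (λ i → i)) (sgn τ))) (allMaps N N) ⟩
  ∑[ τ ∈ allMaps N N ] when (τ ≡ᵐ (λ i → i)) (sgn τ)
    ≡⟨ ∑-allMaps-point {N} (λ i → i) sgn sgn-cong ⟩
  sgn {N} (λ i → i)
    ≡⟨ sgn-id N ⟩
  + 1 ∎
  where open ≡-Reasoning

pathsFrom : ℕ → ℕ → ℤ
pathsFrom h m = ∑[ p ∈ allPaths m ] ι (validFrom h p)

R≡pathsFrom : ∀ n → + R n ≡ pathsFrom 0 n
R≡pathsFrom n = trans (sum-pos (λ p → if isRiordan p then 1 else 0) (allPaths n))
                      (∑-cong (λ p → ι-pos (isRiordan p)) (allPaths n))
  where
  sum-pos : ∀ {A : Set} (f : A → ℕ) xs → + foldr ℕ._+_ 0 (map f xs) ≡ ∑[ x ∈ xs ] + f x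
  sum-pos f [] = refl
  sum-pos f (x ∷ xs) = trans (ℤ.pos-+ (f x) _) (cong (_+_ (+ f x)) (sum-pos f xs))

pathsFrom-suc : ∀ h m →
  pathsFrom h (suc m) ≡ ∑[ s ∈ U ∷ F ∷ D ∷ [] ] ∑[ p ∈ allPaths m ] ι (validFrom h (s Vec.∷ p))
pathsFrom-suc h m =
  trans (∑-concatMap (λ p → ι (validFrom h p)) (λ s → map (s Vec.∷_) (allPaths m)) (U ∷ F ∷ D ∷ []))
        (∑-cong (λ s → ∑-map (λ p → ι (validFrom h p)) (s Vec.∷_) (allPaths m)) (U ∷ F ∷ D ∷ []))

pathsFrom-axis : ∀ m → pathsFrom 0 (suc m) ≡ pathsFrom 1 m
pathsFrom-axis m = trans (pathsFrom-suc 0 m) (+-vanishʳ (cong₂ _+_ blocked (cong (_+ + 0) blocked)))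
  where
  blocked : ∑[ p ∈ allPaths m ] (+ 0) ≡ + 0
  blocked = ∑-zero (λ _ → refl) (allPaths m)

pathsFrom-above : ∀ h m → pathsFrom (suc h) (suc m) ≡ pathsFrom (suc (suc h)) m + (pathsFrom (suc h) m + pathsFrom h m)
pathsFrom-above h m =
  trans (pathsFrom-suc (suc h) m)
        (cong (_+_ (pathsFrom (suc (suc h)) m)) (cong (_+_ (pathsFrom (suc h) m)) (ℤ.+-identityʳ _)))

pathsFrom-unreachable : ∀ h m → m < h → pathsFrom h m ≡ + 0
pathsFrom-unreachable (suc h) zero _ = refl
pathsFrom-unreachable (suc h) (suc m) (s≤s m<h) =
  trans (pathsFrom-above h m)
        (cong₂ _+_ (pathsFrom-unreachable (suc (suc h)) m (ℕ.m<n⇒m<1+n (ℕ.m<n⇒m<1+n m<h)))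
                   (cong₂ _+_ (pathsFrom-unreachable (suc h) m (ℕ.m<n⇒m<1+n m<h)) (pathsFrom-unreachable h m m<h)))

≡ᵇ-refl : ∀ n → (n ≡ᵇ n) ≡ true
≡ᵇ-refl zero = refl
≡ᵇ-refl (suc n) = ≡ᵇ-refl n

≡ᵇ-≢ : ∀ {m n} → m ≢ n → (m ≡ᵇ n) ≡ false
≡ᵇ-≢ {zero} {zero} 0≢0 = ⊥-elim (0≢0 refl)
≡ᵇ-≢ {zero} {suc n} _ = refl
≡ᵇ-≢ {suc m} {zero} _ = refl
≡ᵇ-≢ {suc m} {suc n} m+1≢n+1 = ≡ᵇ-≢ (m+1≢n+1 ∘ cong suc)

lowerRows-lower : ∀ μ {x y} → x < y → lowerRows x y μ x ≡ μ x - + 1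
lowerRows-lower μ {x} {y} x<y = cong₂ (λ b c → μ x - (ι b + ι c)) (≡ᵇ-refl x) (≡ᵇ-≢ (ℕ.<⇒≢ x<y))

lowerRows-upper : ∀ μ {x y} → x < y → lowerRows x y μ y ≡ μ y - + 1
lowerRows-upper μ {x} {y} x<y =
  cong₂ (λ b c → μ y - (ι b + ι c)) (≡ᵇ-≢ (ℕ.<⇒≢ x<y ∘ sym)) (≡ᵇ-refl y)

lowerRows-other : ∀ μ {x y t} → t ≢ x → t ≢ y → lowerRows x y μ t ≡ μ t
lowerRows-other μ {x} {y} {t} t≢x t≢y =
  trans (cong₂ (λ b c → μ t - (ι b + ι c)) (≡ᵇ-≢ t≢x) (≡ᵇ-≢ t≢y)) (ℤ.+-identityʳ (μ t))

twoColumn : ℕ → ℕ → ℕ → ℤ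
twoColumn a b t = ι (t <ᵇ a) + ι (t <ᵇ a ℕ.+ b)

twoColumn-flat-twos : ∀ a b {t} → suc t < a → twoColumn a b t ≡ twoColumn a b (suc t)
twoColumn-flat-twos a b {t} t+1<a =
  trans (cong₂ (λ u v → ι u + ι v) (<ᵇ-true (ℕ.<-trans (ℕ.n<1+n t) t+1<a))
                                   (<ᵇ-true (ℕ.<-trans (ℕ.n<1+n t) t+1<a+b)))
        (sym (cong₂ (λ u v → ι u + ι v) (<ᵇ-true t+1<a) (<ᵇ-true t+1<a+b)))
  where
  t+1<a+b : suc t < a ℕ.+ b
  t+1<a+b = ℕ.<-≤-trans t+1<a (ℕ.m≤m+n a b)

twoColumn-flat-ones : ∀ a b {t} → a ≤ t → suc t < a ℕ.+ b → twoColumn a b t ≡ twoColumn a b (suc t)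
twoColumn-flat-ones a b a≤t t+1<a+b =
  trans (cong₂ (λ u v → ι u + ι v) (<ᵇ-false a≤t) (<ᵇ-true (ℕ.<-trans (ℕ.n<1+n _) t+1<a+b)))
        (sym (cong₂ (λ u v → ι u + ι v) (<ᵇ-false (ℕ.m≤n⇒m≤1+n a≤t)) (<ᵇ-true t+1<a+b)))

twoColumn-beyond : ∀ a b {t} → a ℕ.+ b ≤ t → twoColumn a b t ≡ + 0
twoColumn-beyond a b a+b≤t =
  cong₂ (λ u v → ι u + ι v) (<ᵇ-false (ℕ.≤-trans (ℕ.m≤m+n a b) a+b≤t)) (<ᵇ-false a+b≤t)

ι-step : ∀ t c → ι (t <ᵇ suc c) - ι (t ≡ᵇ c) ≡ ι (t <ᵇ c)
ι-step zero zero = refl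
ι-step zero (suc c) = refl
ι-step (suc t) zero = refl
ι-step (suc t) (suc c) = ι-step t c

lowerRows-mixed : ∀ a b → lowerRows a (suc (a ℕ.+ b)) (twoColumn (suc a) (suc b)) ≗ twoColumn a (suc b)
lowerRows-mixed a b t = begin
  ι (t <ᵇ suc a) + ι (t <ᵇ suc (a ℕ.+ suc b)) - (ι (t ≡ᵇ a) + ι (t ≡ᵇ suc (a ℕ.+ b)))
    ≡⟨ cong (λ m → ι (t <ᵇ suc a) + ι (t <ᵇ suc (a ℕ.+ suc b)) - (ι (t ≡ᵇ a) + ι (t ≡ᵇ m)))
            (sym (ℕ.+-suc a b)) ⟩
  ι (t <ᵇ suc a) + ι (t <ᵇ suc (a ℕ.+ suc b)) - (ι (t ≡ᵇ a) + ι (t ≡ᵇ a ℕ.+ suc b))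
    ≡⟨ regroup (ι (t <ᵇ suc a)) _ _ _ ⟩
  (ι (t <ᵇ suc a) - ι (t ≡ᵇ a)) + (ι (t <ᵇ suc (a ℕ.+ suc b)) - ι (t ≡ᵇ a ℕ.+ suc b))
    ≡⟨ cong₂ _+_ (ι-step t a) (ι-step t (a ℕ.+ suc b)) ⟩
  twoColumn a (suc b) t ∎
  where
  open ≡-Reasoning
  regroup : ∀ p q r s → p + q - (r + s) ≡ (p - r) + (q - s)
  regroup = solve-∀

lowerRows-twos : ∀ a b → lowerRows a (suc a) (twoColumn (suc (suc a)) b) ≗ twoColumn a (suc (suc b))
lowerRows-twos a b t = begin
  ι (t <ᵇ suc (suc a)) + ι (t <ᵇ suc (suc (a ℕ.+ b))) - (ι (t ≡ᵇ a) + ι (t ≡ᵇ suc a))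
    ≡⟨ regroup (ι (t <ᵇ suc (suc a))) _ _ _ ⟩
  (ι (t <ᵇ suc (suc a)) - ι (t ≡ᵇ suc a) - ι (t ≡ᵇ a)) + ι (t <ᵇ suc (suc (a ℕ.+ b)))
    ≡⟨ cong₂ _+_ (trans (cong (_- ι (t ≡ᵇ a)) (ι-step t (suc a))) (ι-step t a))
                 (cong (λ m → ι (t <ᵇ m)) (sym (trans (ℕ.+-suc a (suc b)) (cong suc (ℕ.+-suc a b))))) ⟩
  twoColumn a (suc (suc b)) t ∎
  where
  open ≡-Reasoning
  regroup : ∀ p q r s → p + q - (r + s) ≡ (p - s - r) + q
  regroup = solve-∀

lowerRows-ones : ∀ a b → lowerRows (a ℕ.+ b) (a ℕ.+ suc b) (twoColumn a (suc (suc b))) ≗ twoColumn a b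
lowerRows-ones a b t = begin
  ι (t <ᵇ a) + ι (t <ᵇ a ℕ.+ suc (suc b)) - (ι (t ≡ᵇ a ℕ.+ b) + ι (t ≡ᵇ a ℕ.+ suc b))
    ≡⟨ regroup (ι (t <ᵇ a)) _ _ _ ⟩
  ι (t <ᵇ a) + (ι (t <ᵇ a ℕ.+ suc (suc b)) - ι (t ≡ᵇ a ℕ.+ suc b) - ι (t ≡ᵇ a ℕ.+ b))
    ≡⟨ cong (_+_ (ι (t <ᵇ a))) (begin
         ι (t <ᵇ a ℕ.+ suc (suc b)) - ι (t ≡ᵇ a ℕ.+ suc b) - ι (t ≡ᵇ a ℕ.+ b)
           ≡⟨ cong (λ m → ι (t <ᵇ m) - ι (t ≡ᵇ a ℕ.+ suc b) - ι (t ≡ᵇ a ℕ.+ b))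
                   (ℕ.+-suc a (suc b)) ⟩
         ι (t <ᵇ suc (a ℕ.+ suc b)) - ι (t ≡ᵇ a ℕ.+ suc b) - ι (t ≡ᵇ a ℕ.+ b)
           ≡⟨ cong (_- ι (t ≡ᵇ a ℕ.+ b)) (ι-step t (a ℕ.+ suc b)) ⟩
         ι (t <ᵇ a ℕ.+ suc b) - ι (t ≡ᵇ a ℕ.+ b)
           ≡⟨ cong (λ m → ι (t <ᵇ m) - ι (t ≡ᵇ a ℕ.+ b)) (ℕ.+-suc a b) ⟩
         ι (t <ᵇ suc (a ℕ.+ b)) - ι (t ≡ᵇ a ℕ.+ b)
           ≡⟨ ι-step t (a ℕ.+ b) ⟩
         ι (t <ᵇ a ℕ.+ b) ∎) ⟩
  twoColumn a b t ∎
  where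
  open ≡-Reasoning
  regroup : ∀ p q r s → p + q - (r + s) ≡ p + (q - s - r)
  regroup = solve-∀

module PairRemoval (N : ℕ) (H : (ℕ → ℤ) → ℤ)
  (H-cong : ∀ {μ ν} → μ ≗ ν → H μ ≡ H ν)
  (H-straighten : ∀ μ p → suc p < N → μ (suc p) ≡ μ p + + 1 → H μ ≡ + 0)
  (H-lastRow : ∀ μ y → suc y ≡ N → μ y ≡ -[1+ 0 ] → H μ ≡ + 0) where

  private
    lower-then-raise : ∀ m → m ≡ m - + 1 + + 1
    lower-then-raise = solve-∀

  vanish-upper : ∀ μ {x y} → x < y → suc y < N → μ y ≡ μ (suc y) → H (lowerRows x y μ) ≡ + 0
  vanish-upper μ {x} {y} x<y y+1<N flat = H-straighten (lowerRows x y μ) y y+1<N (begin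
    lowerRows x y μ (suc y)
      ≡⟨ lowerRows-other μ (ℕ.<⇒≢ (ℕ.m<n⇒m<1+n x<y) ∘ sym) (ℕ.<⇒≢ (ℕ.n<1+n y) ∘ sym) ⟩
    μ (suc y)                 ≡⟨ flat ⟨
    μ y                       ≡⟨ lower-then-raise (μ y) ⟩
    μ y - + 1 + + 1           ≡⟨ cong (_+ + 1) (lowerRows-upper μ x<y) ⟨
    lowerRows x y μ y + + 1   ∎)
    where open ≡-Reasoning

  vanish-lower : ∀ μ {x y} → suc x < y → y < N → μ x ≡ μ (suc x) → H (lowerRows x y μ) ≡ + 0
  vanish-lower μ {x} {y} x+1<y y<N flat = H-straighten (lowerRows x y μ) x (ℕ.<-trans x+1<y y<N) (begin
    lowerRows x y μ (suc x)
      ≡⟨ lowerRows-other μ (ℕ.<⇒≢ (ℕ.n<1+n x) ∘ sym) (ℕ.<⇒≢ x+1<y) ⟩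
    μ (suc x)                 ≡⟨ flat ⟨
    μ x                       ≡⟨ lower-then-raise (μ x) ⟩
    μ x - + 1 + + 1           ≡⟨ cong (_+ + 1) (lowerRows-lower μ x<y) ⟨
    lowerRows x y μ x + + 1   ∎)
    where
    open ≡-Reasoning
    x<y : x < y
    x<y = ℕ.<-trans (ℕ.n<1+n x) x+1<y

  vanish-last : ∀ μ {x y} → x < y → suc y ≡ N → μ y ≡ + 0 → H (lowerRows x y μ) ≡ + 0
  vanish-last μ {x} {y} x<y y+1≡N empty =
    H-lastRow (lowerRows x y μ) y y+1≡N (trans (lowerRows-upper μ x<y) (cong (_- + 1) empty))

  removals : (ℕ → ℤ) → ℕ → ℤ
  removals μ y = ∑[ x < y ] H (lowerRows x y μ)

  mixedRemoval twoRowRemoval oneRowRemoval : ℕ → ℕ → ℤ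
  mixedRemoval (suc a) (suc b) = H (twoColumn a (suc b))
  mixedRemoval zero b = + 0
  mixedRemoval (suc a) zero = + 0
  twoRowRemoval (suc (suc a)) b = H (twoColumn a (suc (suc b)))
  twoRowRemoval zero b = + 0
  twoRowRemoval (suc zero) b = + 0
  oneRowRemoval a (suc (suc b)) = H (twoColumn a b)
  oneRowRemoval a zero = + 0
  oneRowRemoval a (suc zero) = + 0

  removals-twos : ∀ a b → a ≤ N → ∑< a (removals (twoColumn a b)) ≡ twoRowRemoval a b
  removals-twos zero b _ = refl
  removals-twos (suc a) b a<N =
    trans (∑<-last a (removals (twoColumn (suc a) b))
            (λ t t<a → ∑<-zero t (λ x x<t →
               vanish-upper (twoColumn (suc a) b) x<t (ℕ.<-≤-trans (s≤s t<a) a<N)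
                            (twoColumn-flat-twos (suc a) b (s≤s t<a)))))
          (last-row a a<N)
    where
    last-row : ∀ a → suc a ≤ N → removals (twoColumn (suc a) b) a ≡ twoRowRemoval (suc a) b
    last-row zero _ = refl
    last-row (suc a) a+1<N =
      trans (∑<-last a (λ x → H (lowerRows x (suc a) (twoColumn (suc (suc a)) b)))
              (λ x x<a → vanish-lower (twoColumn (suc (suc a)) b) (s≤s x<a) a+1<N
                                      (twoColumn-flat-twos (suc (suc a)) b (s≤s (ℕ.m<n⇒m<1+n x<a)))))
            (H-cong (lowerRows-twos a b))

  removals-ones : ∀ a b → a ℕ.+ b ≤ N →
                  ∑[ t < b ] removals (twoColumn a b) (a ℕ.+ t) ≡ mixedRemoval a b + oneRowRemoval a b
  removals-ones zero zero _ = refl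
  removals-ones (suc a) zero _ = refl
  removals-ones a (suc b) a+b<N =
    trans (∑<-last b (λ t → removals μ (a ℕ.+ t))
            (λ t t<b → ∑<-zero (a ℕ.+ t) (λ x x<y →
               vanish-upper μ x<y (ℕ.<-≤-trans (within (s≤s t<b)) a+b<N)
                             (twoColumn-flat-ones a (suc b) (ℕ.m≤m+n a t) (within (s≤s t<b))))))
          (trans (∑<-+ a b (λ x → H (lowerRows x (a ℕ.+ b) μ)))
                 (cong₂ _+_ (from-twos a a+b<N) (from-ones b a+b<N)))
    where
    μ : ℕ → ℤ
    μ = twoColumn a (suc b)
    within : ∀ {a s t} → suc s < t → suc (a ℕ.+ s) < a ℕ.+ t
    within {a} {s} {t} s+1<t = subst (_< a ℕ.+ t) (ℕ.+-suc a s) (ℕ.+-monoʳ-< a s+1<t)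
    from-twos : ∀ a → a ℕ.+ suc b ≤ N →
                ∑[ x < a ] H (lowerRows x (a ℕ.+ b) (twoColumn a (suc b))) ≡ mixedRemoval a (suc b)
    from-twos zero _ = refl
    from-twos (suc a) a+b<N =
      trans (∑<-last a (λ x → H (lowerRows x (suc a ℕ.+ b) (twoColumn (suc a) (suc b))))
              (λ x x<a → vanish-lower (twoColumn (suc a) (suc b)) (s≤s (ℕ.<-≤-trans x<a (ℕ.m≤m+n a b)))
                                      (subst (λ m → suc m ≤ N) (ℕ.+-suc a b) a+b<N)
                                      (twoColumn-flat-twos (suc a) (suc b) (s≤s x<a))))
            (H-cong (lowerRows-mixed a b))
    from-ones : ∀ b → a ℕ.+ suc b ≤ N →
                ∑[ s < b ] H (lowerRows (a ℕ.+ s) (a ℕ.+ b) (twoColumn a (suc b))) ≡ oneRowRemoval a (suc b)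
    from-ones zero _ = refl
    from-ones (suc b) a+b<N =
      trans (∑<-last b (λ s → H (lowerRows (a ℕ.+ s) (a ℕ.+ suc b) (twoColumn a (suc (suc b)))))
              (λ s s<b → vanish-lower (twoColumn a (suc (suc b))) (within (s≤s s<b))
                                      (ℕ.<-≤-trans (ℕ.+-monoʳ-< a (ℕ.n<1+n (suc b))) a+b<N)
                                      (twoColumn-flat-ones a (suc (suc b)) (ℕ.m≤m+n a s)
                                                           (within (s≤s (ℕ.m<n⇒m<1+n s<b))))))
            (H-cong (lowerRows-ones a b))

  removals-empty : ∀ a b r → a ℕ.+ b ℕ.+ r ≡ N → ∑[ t < r ] removals (twoColumn a b) (a ℕ.+ b ℕ.+ t) ≡ + 0
  removals-empty a b r a+b+r≡N = ∑<-zero r (λ t t<r → ∑<-zero (a ℕ.+ b ℕ.+ t) (λ x x<y → vanishing t<r x<y))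
    where
    vanishing : ∀ {t x} → t < r → x < a ℕ.+ b ℕ.+ t → H (lowerRows x (a ℕ.+ b ℕ.+ t) (twoColumn a b)) ≡ + 0
    vanishing {t} t<r x<y with ℕ.m≤n⇒m<n∨m≡n t<r
    ... | inj₁ t+1<r = vanish-upper (twoColumn a b) x<y
            (subst (suc (a ℕ.+ b ℕ.+ t) <_) a+b+r≡N
                   (subst (_< a ℕ.+ b ℕ.+ r) (ℕ.+-suc (a ℕ.+ b) t) (ℕ.+-monoʳ-< (a ℕ.+ b) t+1<r)))
            (trans (twoColumn-beyond a b (ℕ.m≤m+n (a ℕ.+ b) t))
                   (sym (twoColumn-beyond a b (ℕ.m≤n⇒m≤1+n (ℕ.m≤m+n (a ℕ.+ b) t)))))
    ... | inj₂ t+1≡r = vanish-last (twoColumn a b) x<y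
            (trans (sym (ℕ.+-suc (a ℕ.+ b) t)) (trans (cong (a ℕ.+ b ℕ.+_) t+1≡r) a+b+r≡N))
            (twoColumn-beyond a b (ℕ.m≤m+n (a ℕ.+ b) t))

  -- Straightening kills every pair of rows except the last rows of lengths 2 and 1, the last
  -- two rows of length 2, and the last two rows of length 1.
  removals-twoColumn : ∀ a b → a ℕ.+ b ≤ N →
    ∑< N (removals (twoColumn a b)) ≡ mixedRemoval a b + twoRowRemoval a b + oneRowRemoval a b
  removals-twoColumn a b a+b≤N = begin
    ∑< N (removals μ)
      ≡⟨ cong (λ n → ∑< n (removals μ)) a+b+r≡N ⟨
    ∑< (a ℕ.+ b ℕ.+ r) (removals μ)
      ≡⟨ ∑<-+ (a ℕ.+ b) r (removals μ) ⟩
    ∑< (a ℕ.+ b) (removals μ) + (∑[ t < r ] removals μ (a ℕ.+ b ℕ.+ t))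
      ≡⟨ cong₂ _+_ (∑<-+ a b (removals μ)) (removals-empty a b r a+b+r≡N) ⟩
    ∑< a (removals μ) + (∑[ t < b ] removals μ (a ℕ.+ t)) + + 0
      ≡⟨ cong (_+ + 0) (cong₂ _+_ (removals-twos a b (ℕ.m+n≤o⇒m≤o a a+b≤N)) (removals-ones a b a+b≤N)) ⟩
    twoRowRemoval a b + (mixedRemoval a b + oneRowRemoval a b) + + 0
      ≡⟨ rearrange (mixedRemoval a b) (twoRowRemoval a b) (oneRowRemoval a b) ⟩
    mixedRemoval a b + twoRowRemoval a b + oneRowRemoval a b ∎
    where
    open ≡-Reasoning
    μ : ℕ → ℤ
    μ = twoColumn a b
    r : ℕ
    r = N ∸ (a ℕ.+ b)
    a+b+r≡N : a ℕ.+ b ℕ.+ r ≡ N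
    a+b+r≡N = ℕ.m+[n∸m]≡n a+b≤N
    rearrange : ∀ x y z → y + (x + z) + + 0 ≡ x + y + z
    rearrange = solve-∀

m11-power-cong : ∀ N k {μ ν : ℕ → ℤ} → μ ≗ ν →
                 hallSchurℤ N (powP (m11 N) k) μ ≡ hallSchurℤ N (powP (m11 N) k) ν
m11-power-cong N k {μ} {ν} μ≗ν = hallSchurℤ-cong N (powP (m11 N) k) (powP-cong (m11 N) k) {μ} {ν} (μ≗ν ∘ toℕ)

m11-power-straighten : ∀ N k μ p → suc p < N → μ (suc p) ≡ μ p + + 1 →
                       hallSchurℤ N (powP (m11 N) k) μ ≡ + 0
m11-power-straighten zero k μ p ()
m11-power-straighten (suc M) k =
  hallSchurℤ-straighten (powP (m11 (suc M)) k) (powP-cong (m11 (suc M)) k) (m11-power-swapInvariant k)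

module Removals N k = PairRemoval N (hallSchurℤ N (powP (m11 N) k))
  (m11-power-cong N k) (m11-power-straighten N k) (hallSchurℤ-lastRow N (powP (m11 N) k))

module RemovalsAsSteps (N k : ℕ)
  (induction : ∀ a h → a ℕ.+ h ≡ k → a ℕ.+ h ℕ.* 2 ≤ N →
               hallSchurℤ N (powP (m11 N) k) (twoColumn a (h ℕ.* 2)) ≡ pathsFrom h k) where

  open Removals N k

  up : ∀ a h → a ℕ.+ h ≡ suc k → a ℕ.+ h ℕ.* 2 ≤ N → twoRowRemoval a (h ℕ.* 2) ≡ pathsFrom (suc h) k
  up zero h refl _ = sym (pathsFrom-unreachable (suc h) k (ℕ.m<n⇒m<1+n (ℕ.n<1+n k)))
  up (suc zero) h refl _ = sym (pathsFrom-unreachable (suc h) k (ℕ.n<1+n k))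
  up (suc (suc a)) h a+h≡k+1 bound = induction a (suc h)
    (trans (ℕ.+-suc a h) (ℕ.suc-injective a+h≡k+1))
    (subst (_≤ N) (sym (trans (ℕ.+-suc a (suc (h ℕ.* 2))) (cong suc (ℕ.+-suc a (h ℕ.* 2))))) bound)

  flat : ∀ a h → a ℕ.+ suc h ≡ suc k → a ℕ.+ suc h ℕ.* 2 ≤ N →
         mixedRemoval a (suc h ℕ.* 2) ≡ pathsFrom (suc h) k
  flat zero h refl _ = sym (pathsFrom-unreachable (suc h) h (ℕ.n<1+n h))
  flat (suc a) h a+h≡k bound = induction a (suc h) (ℕ.suc-injective a+h≡k) (ℕ.≤-trans (ℕ.n≤1+n _) bound)

  down : ∀ a h → a ℕ.+ suc h ≡ suc k → a ℕ.+ suc h ℕ.* 2 ≤ N →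
         oneRowRemoval a (suc h ℕ.* 2) ≡ pathsFrom h k
  down a h a+h≡k bound = induction a h
    (ℕ.suc-injective (trans (sym (ℕ.+-suc a h)) a+h≡k))
    (ℕ.≤-trans (ℕ.+-monoʳ-≤ a (ℕ.≤-trans (ℕ.n≤1+n _) (ℕ.n≤1+n _))) bound)

  -- Without rows of length 1 (h = 0) there is no mixed removal: no F step on the axis.
  flat-axis : ∀ a → mixedRemoval a 0 ≡ + 0
  flat-axis zero = refl
  flat-axis (suc a) = refl

  removals-pathsFrom : ∀ a h → a ℕ.+ h ≡ suc k → a ℕ.+ h ℕ.* 2 ≤ N →
    mixedRemoval a (h ℕ.* 2) + twoRowRemoval a (h ℕ.* 2) + oneRowRemoval a (h ℕ.* 2) ≡ pathsFrom h (suc k)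
  removals-pathsFrom a zero a≡k+1 bound =
    trans (+-vanishʳ refl) (trans (+-vanishˡ (flat-axis a)) (trans (up a zero a≡k+1 bound) (sym (pathsFrom-axis k))))
  removals-pathsFrom a (suc h) a+h≡k+1 bound =
    trans (cong₂ _+_ (cong₂ _+_ (flat a h a+h≡k+1 bound) (up a (suc h) a+h≡k+1 bound)) (down a h a+h≡k+1 bound))
          (trans (rearrange (pathsFrom (suc h) k) (pathsFrom (suc (suc h)) k) (pathsFrom h k)) (sym (pathsFrom-above h k)))
    where
    rearrange : ∀ x y z → x + y + z ≡ y + (x + z)
    rearrange = solve-∀

twoColumn-pathsFrom : ∀ N k a h → a ℕ.+ h ≡ k → a ℕ.+ h ℕ.* 2 ≤ N →
                      hallSchurℤ N (powP (m11 N) k) (twoColumn a (h ℕ.* 2)) ≡ pathsFrom h k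
twoColumn-pathsFrom N zero zero zero refl _ = hallSchurℤ-oneP N
twoColumn-pathsFrom N (suc k) a h a+h≡k+1 bound = begin
  hallSchurℤ N (mulP (m11 N) (powP (m11 N) k)) (twoColumn a (h ℕ.* 2))
    ≡⟨ hallSchurℤ-m11 N (powP (m11 N) k) (powP-cong (m11 N) k) (twoColumn a (h ℕ.* 2)) ⟩
  ∑< N (removals (twoColumn a (h ℕ.* 2)))
    ≡⟨ removals-twoColumn a (h ℕ.* 2) bound ⟩
  mixedRemoval a (h ℕ.* 2) + twoRowRemoval a (h ℕ.* 2) + oneRowRemoval a (h ℕ.* 2)
    ≡⟨ removals-pathsFrom a h a+h≡k+1 bound ⟩
  pathsFrom h (suc k) ∎
  where
  open ≡-Reasoning
  open Removals N k
  open RemovalsAsSteps N k (twoColumn-pathsFrom N k)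

proposition4p1 : (n : ℕ) → n ≥ 1 →
    hallSchur n (powP (m11 n) n) (λ _ → 2) ≡ + R n
proposition4p1 n _ = begin
  hallSchur n (powP (m11 n) n) (λ _ → 2)
    ≡⟨⟩
  hallSchurℤ n (powP (m11 n) n) (λ _ → + 2)
    ≡⟨ hallSchurℤ-cong n (powP (m11 n) n) (powP-cong (m11 n) n) {ν = twoColumn n 0} (λ i → sym (full-rows i)) ⟩
  hallSchurℤ n (powP (m11 n) n) (twoColumn n 0)
    ≡⟨ twoColumn-pathsFrom n n n 0 (ℕ.+-identityʳ n) (ℕ.≤-reflexive (ℕ.+-identityʳ n)) ⟩
  pathsFrom 0 n
    ≡⟨ R≡pathsFrom n ⟨
  + R n ∎
  where
  open ≡-Reasoning
  full-rows : ∀ (i : Fin n) → twoColumn n 0 (toℕ i) ≡ + 2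
  full-rows i = cong₂ (λ u v → ι u + ι v)
    (<ᵇ-true (toℕ<n i)) (<ᵇ-true (subst (toℕ i <_) (sym (ℕ.+-identityʳ n)) (toℕ<n i)))
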